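{- Let $A\in\{0,\pm1\}^{m\times n}$ be totally unimodular, $w\in\mathbb{Z}^n$, and $\Delta\ge 1$. Then the matrix $\begin{bmatrix}A\\ w^\intercal\end{bmatrix}$ is totally $\Delta$-modular if and only if every circuit $\begin{bmatrix}x\\ y\end{bmatrix}$ (with $x\in\mathbb{R}^n$, $y\in\mathbb{R}^m$) of $\begin{bmatrix}A & \mathbf{I}\end{bmatrix}$ satisfies $|w^\intercal x|\le\Delta$.
   Context: A matrix is totally unimodular if all its square subdeterminants are in $\{ -1,0,1\}$, and totally $\Delta$-modular if all its square subdeterminants are in $\{ -\Delta,\dots,\Delta\}$. A circuit of a rational matrix $B$ is a nonzero integer vector $x\in\ker(B)$ whose entries have gcd $1$ and whose support is inclusion-wise minimal among supports of nonzero vectors of $\ker(B)$. $\mathbf{I}$ denotes the $m\times m$ identity matrix. -}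

module Defs where

open import Data.Nat as ℕ using (ℕ; zero; suc)
open import Data.Nat.GCD using (gcd)
open import Data.Integer as ℤ using (ℤ; +_; -_; ∣_∣)
open import Data.Rational as ℚ using (ℚ; 0ℚ)
open import Data.Fin using (Fin; zero; suc; punchIn; splitAt; _↑ˡ_; _↑ʳ_; _≟_)
open import Data.Sum using (inj₁; inj₂; _⊎_)
open import Data.Product using (∃; _×_)
open import Data.Empty using (⊥)
open import Relation.Nullary using (¬_; yes; no)
open import Relation.Binary.PropositionalEquality using (_≡_)
open import Function.Definitions using (Injective)

Matrix : Set → ℕ → ℕ → Set
Matrix A m n = Fin m → Fin n → A

sumℤ : ∀ {k} → (Fin k → ℤ) → ℤ
sumℤ {zero}  f = + 0
sumℤ {suc k} f = f zero ℤ.+ sumℤ (λ i → f (suc i))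

sumℚ : ∀ {k} → (Fin k → ℚ) → ℚ
sumℚ {zero}  f = 0ℚ
sumℚ {suc k} f = f zero ℚ.+ sumℚ (λ i → f (suc i))

signFin : ∀ {k} → Fin k → ℤ
signFin zero    = + 1
signFin (suc j) = - signFin j

det : ∀ k → Matrix ℤ k k → ℤ
det zero    M = + 1
det (suc k) M = sumℤ (λ j → signFin j ℤ.* (M zero j ℤ.* det k (λ r c → M (suc r) (punchIn j c))))

-- Square submatrix selected by k distinct rows and k distinct columns
-- (row/column order only affects the sign of the determinant).
submatrix : ∀ {m n k} → Matrix ℤ m n → (Fin k → Fin m) → (Fin k → Fin n) → Matrix ℤ k k
submatrix M r c i j = M (r i) (c j)

TotallyΔModular : ∀ {m n} → ℕ → Matrix ℤ m n → Set
TotallyΔModular {m} {n} Δ M =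
  ∀ k (r : Fin k → Fin m) (c : Fin k → Fin n) →
  Injective _≡_ _≡_ r → Injective _≡_ _≡_ c →
  ∣ det k (submatrix M r c) ∣ ℕ.≤ Δ

TotallyUnimodular : ∀ {m n} → Matrix ℤ m n → Set
TotallyUnimodular {m} {n} M =
  ∀ k (r : Fin k → Fin m) (c : Fin k → Fin n) →
  Injective _≡_ _≡_ r → Injective _≡_ _≡_ c →
  ∣ det k (submatrix M r c) ∣ ℕ.≤ 1

ZeroPmOne : ∀ {m n} → Matrix ℤ m n → Set
ZeroPmOne M = ∀ i j → (M i j ≡ + 0) ⊎ ((M i j ≡ + 1) ⊎ (M i j ≡ - (+ 1)))


-- gcd of all entries of an integer vector (gcd of the empty vector is 0)
gcdVec : ∀ {k} → (Fin k → ℤ) → ℕ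
gcdVec {zero}  x = 0
gcdVec {suc k} x = gcd ∣ x zero ∣ (gcdVec (λ i → x (suc i)))

InKerℚ : ∀ {m n} → Matrix ℤ m n → (Fin n → ℚ) → Set
InKerℚ M q = ∀ i → sumℚ (λ j → ℚ._/_ (M i j) 1 ℚ.* q j) ≡ 0ℚ

toℚ : ℤ → ℚ
toℚ z = ℚ._/_ z 1

-- A circuit: nonzero integer kernel vector, entries with gcd 1, whose support
-- is inclusion-wise minimal among supports of nonzero (rational) kernel vectors.
IsCircuit : ∀ {m n} → Matrix ℤ m n → (Fin n → ℤ) → Set
IsCircuit {m} {n} M x =
  InKerℚ M (λ j → toℚ (x j)) ×
  (∃ λ j → ¬ (x j ≡ + 0)) ×
  (gcdVec x ≡ 1) ×
  (∀ (q : Fin n → ℚ) → InKerℚ M q → (∃ λ j → ¬ (q j ≡ 0ℚ)) →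
     (∀ j → ¬ (q j ≡ 0ℚ) → ¬ (x j ≡ + 0)) →
     (∀ j → ¬ (x j ≡ + 0) → ¬ (q j ≡ 0ℚ)))

appendRow : ∀ {m n} → Matrix ℤ m n → (Fin n → ℤ) → Matrix ℤ (m ℕ.+ 1) n
appendRow {m} A w i j with splitAt m i
... | inj₁ r = A r j
... | inj₂ _ = w j

idMat : ∀ m → Matrix ℤ m m
idMat m i k with i ≟ k
... | yes _ = + 1
... | no  _ = + 0

appendId : ∀ {m n} → Matrix ℤ m n → Matrix ℤ m (n ℕ.+ m)
appendId {m} {n} A i j with splitAt n j
... | inj₁ c = A i c
... | inj₂ k = idMat m i k

dot : ∀ {n} → (Fin n → ℤ) → (Fin n → ℤ) → ℤ
dot w x = sumℤ (λ j → w j ℤ.* x j)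

module Submission where

-- A square submatrix of [A; wᵀ] that avoids the row wᵀ is a submatrix of A, so its determinant
-- is at most 1 in absolute value. Otherwise, expanding along the row wᵀ gives ±Σⱼ w_{c j} vⱼ,
-- where v is the vector of signed maximal minors (cofactors) of a k × (k+1) submatrix A[ρ, c].
-- If v ≠ 0, then v extended by zero and completed by the slacks −Av is a circuit of [A I]: its
-- entries lie in {0, ±1} by total unimodularity, and Cramer's rule makes every kernel vector with
-- smaller support proportional to it. Conversely, if [x; y] is a circuit, minimality of its support
-- shows that the columns of supp x other than the first are independent on the rows where y
-- vanishes; a nonsingular minor there and Cramer's rule make x a multiple of such a cofactor vector,
-- and gcd 1 forces the multiplier to be ±1. So the values wᵀx on circuits are, up to sign, exactly
-- the determinants of square submatrices of [A; wᵀ] containing the row wᵀ.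

open import Level using (0ℓ)
open import Algebra.Bundles using (CommutativeRing)
open import Algebra.Core using (Op₁; Op₂)
open import Algebra.Structures using (IsCommutativeRing)
open import Data.Nat as ℕ using (ℕ; zero; suc)
import Data.Nat.Properties as ℕP
open import Data.Nat.Divisibility using (_∣_; _∣0; ∣-trans; ∣1⇒≡1; m∣m*n)
open import Data.Nat.GCD using (gcd-greatest; gcd[m,n]∣m; gcd[m,n]∣n)
import Data.Nat.Coprimality as Coprime
open import Data.Integer as ℤ using (ℤ; +_; -[1+_]; +[1+_]; ∣_∣)
import Data.Integer.Properties as ℤP
open import Data.Rational as ℚ using (ℚ; mkℚ; 0ℚ; 1ℚ)
import Data.Rational.Properties as ℚP
open import Data.Fin as Fin using (Fin; zero; suc; punchIn; punchOut; splitAt; _↑ˡ_; _↑ʳ_; _≟_)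
open import Data.Fin.Properties
  using ( punchInᵢ≢i; punchIn-punchOut; punchIn-injective; suc-injective; 0≢1+n; any?
        ; splitAt-↑ˡ; splitAt-↑ʳ; splitAt⁻¹-↑ˡ; splitAt⁻¹-↑ʳ; ↑ˡ-injective )
open import Data.Vec.Functional using (Vector; _∷_; _++_; updateAt; removeAt)
open import Data.Vec.Functional.Properties
  using (updateAt-updates; updateAt-minimal; updateAt-id-local; lookup-++ˡ; lookup-++ʳ)
open import Data.Product using (Σ; ∃; _×_; _,_; proj₁; proj₂)
open import Data.Sum using (inj₁; inj₂)
open import Data.Empty using (⊥-elim)
open import Function.Base using (_∘_; const)
open import Function.Definitions using (Injective)
open import Function.Bundles using (_⇔_; mk⇔)
open import Relation.Nullary using (yes; no)
open import Relation.Nullary.Decidable using (¬?)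
open import Relation.Unary using (Decidable)
open import Relation.Binary.Definitions using (DecidableEquality)
open import Relation.Binary.PropositionalEquality
open import Defs using (Matrix)

record Enumeration {n} (P : Fin n → Set) : Set where
  field
    size           : ℕ
    elem           : Fin size → Fin n
    elem-injective : Injective _≡_ _≡_ elem
    elem-∈         : ∀ j → P (elem j)
    elem-complete  : ∀ b → P b → ∃ λ j → elem j ≡ b

enumerate : ∀ {n} {P : Fin n → Set} → Decidable P → Enumeration P
enumerate {zero}      P? = record
  { size = 0 ; elem = λ () ; elem-injective = λ { {()} } ; elem-∈ = λ () ; elem-complete = λ () }
enumerate {suc n} {P} P? with enumerate (P? ∘ suc) | P? zero
... | E | yes P0 = record
  { size           = suc size
  ; elem           = zero ∷ suc ∘ elem
  ; elem-injective = inj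
  ; elem-∈         = λ { zero → P0 ; (suc j) → elem-∈ j }
  ; elem-complete  = complete
  }
  where
  open Enumeration E
  inj : Injective _≡_ _≡_ (zero ∷ suc ∘ elem)
  inj {zero}  {zero}  _  = refl
  inj {suc i} {suc j} eq = cong suc (elem-injective (suc-injective eq))
  complete : ∀ b → P b → ∃ λ j → (zero ∷ suc ∘ elem) j ≡ b
  complete zero    _  = zero , refl
  complete (suc b) Pb = let j , eq = elem-complete b Pb in suc j , cong suc eq
... | E | no ¬P0 = record
  { size           = size
  ; elem           = suc ∘ elem
  ; elem-injective = elem-injective ∘ suc-injective
  ; elem-∈         = elem-∈
  ; elem-complete  = complete
  }
  where
  open Enumeration E
  complete : ∀ b → P b → ∃ λ j → suc (elem j) ≡ b
  complete zero    P0 = ⊥-elim (¬P0 P0)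
  complete (suc b) Pb = let j , eq = elem-complete b Pb in j , cong suc eq

↑ˡ-↑ʳ-elim : ∀ {a b} {P : Fin (a ℕ.+ b) → Set} → (∀ i → P (i ↑ˡ b)) → (∀ l → P (a ↑ʳ l)) → ∀ t → P t
↑ˡ-↑ʳ-elim {a} {b} {P} P↑ˡ P↑ʳ t with splitAt a t in eq
... | inj₁ i = subst P (splitAt⁻¹-↑ˡ eq) (P↑ˡ i)
... | inj₂ l = subst P (splitAt⁻¹-↑ʳ eq) (P↑ʳ l)

-- Determinants over a commutative ring

module Determinant {R : Set} {add mul : Op₂ R} {neg : Op₁ R} {zeroᴿ oneᴿ : R}
  (isCommutativeRing : IsCommutativeRing _≡_ add mul neg zeroᴿ oneᴿ) where

  commutativeRing : CommutativeRing 0ℓ 0ℓ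
  commutativeRing = record { isCommutativeRing = isCommutativeRing }

  open CommutativeRing commutativeRing
    using ( _+_; _*_; -_; 0#; 1#; +-assoc; +-identityˡ; +-identityʳ; -‿inverseʳ
          ; *-assoc; *-comm; *-identityˡ; zeroˡ; zeroʳ
          ; ring; semiring; +-group; +-abelianGroup; +-commutativeSemigroup; *-commutativeSemigroup )
  open import Algebra.Properties.Ring ring public using (-‿distribˡ-*; -‿distribʳ-*)
  open import Algebra.Properties.Ring ring using (-1*x≈-x)
  open import Algebra.Properties.Group +-group public using (inverseʳ-unique)
  open import Algebra.Properties.Group +-group using (⁻¹-involutive; ε⁻¹≈ε)
  open import Algebra.Properties.AbelianGroup +-abelianGroup using (⁻¹-∙-comm)
  open import Algebra.Properties.CommutativeSemigroup *-commutativeSemigroup public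
    using () renaming (x∙yz≈y∙xz to *-exchange)
  open import Algebra.Properties.CommutativeSemigroup +-commutativeSemigroup
    using () renaming (x∙yz≈y∙xz to +-exchange)
  open import Algebra.Properties.Semiring.Sum semiring public
    using (sum; sum-cong-≗; *-distribˡ-sum; *-distribʳ-sum)
  open import Algebra.Properties.Semiring.Sum semiring using (∑-comm; sum-remove; sum-replicate-zero)
  open ≡-Reasoning

  infixr 7 _*ᵥ_
  _*ᵥ_ : ∀ {m n} → Matrix R m n → Vector R n → Vector R m
  (M *ᵥ v) i = sum (λ j → M i j * v j)

  sum-zero : ∀ {k} (f : Vector R k) → (∀ i → f i ≡ 0#) → sum f ≡ 0#
  sum-zero {k} f f≡0 = trans (sum-cong-≗ f≡0) (sum-replicate-zero k)

  sum-neg : ∀ {k} (f : Vector R k) → sum (λ i → - f i) ≡ - sum f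
  sum-neg {zero}  f = sym ε⁻¹≈ε
  sum-neg {suc k} f = trans (cong (_+_ (- f zero)) (sum-neg (f ∘ suc))) (⁻¹-∙-comm _ _)

  sum-single : ∀ {k} (p : Fin k) (f : Vector R k) → (∀ i → i ≢ p → f i ≡ 0#) → sum f ≡ f p
  sum-single {suc k} p f f≡0 = begin
    sum f                        ≡⟨ sum-remove {i = p} f ⟩
    f p + sum (removeAt f p)     ≡⟨ cong (_+_ (f p)) (sum-zero _ (λ i → f≡0 _ (punchInᵢ≢i p i))) ⟩
    f p + 0#                     ≡⟨ +-identityʳ _ ⟩
    f p                          ∎

  sum-splitAt : ∀ a {b} (f : Vector R (a ℕ.+ b)) →
    sum f ≡ sum (λ i → f (i ↑ˡ b)) + sum (λ l → f (a ↑ʳ l))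
  sum-splitAt zero    f = sym (+-identityˡ _)
  sum-splitAt (suc a) f = trans (cong (_+_ (f zero)) (sum-splitAt a (f ∘ suc))) (sym (+-assoc _ _ _))

  unit : ∀ {k} → Fin k → Vector R k
  unit i j with j ≟ i
  ... | yes _ = 1#
  ... | no  _ = 0#

  unit-diag : ∀ {k} (i : Fin k) → unit i i ≡ 1#
  unit-diag i with i ≟ i
  ... | yes _   = refl
  ... | no  i≢i = ⊥-elim (i≢i refl)

  unit-off : ∀ {k} (i j : Fin k) → j ≢ i → unit i j ≡ 0#
  unit-off i j j≢i with j ≟ i
  ... | yes j≡i = ⊥-elim (j≢i j≡i)
  ... | no  _   = refl

  sum-unit : ∀ {k} (i : Fin k) (f : Vector R k) → sum (λ j → unit i j * f j) ≡ f i
  sum-unit i f = begin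
    sum (λ j → unit i j * f j)
      ≡⟨ sum-single i _ (λ j j≢i → trans (cong (_* f j) (unit-off i j j≢i)) (zeroˡ _)) ⟩
    unit i i * f i             ≡⟨ cong (_* f i) (unit-diag i) ⟩
    1# * f i                   ≡⟨ *-identityˡ _ ⟩
    f i                        ∎

  extend : ∀ {k n} → (Fin k → Fin n) → Vector R k → Vector R n
  extend c v b = sum (λ j → unit (c j) b * v j)

  extend-image : ∀ {k n} (c : Fin k → Fin n) → Injective _≡_ _≡_ c → ∀ v j → extend c v (c j) ≡ v j
  extend-image c c-inj v j = begin
    extend c v (c j)
      ≡⟨ sum-single j _ (λ i i≢j → trans (cong (_* v i) (unit-off (c i) (c j) (i≢j ∘ c-inj ∘ sym))) (zeroˡ _)) ⟩
    unit (c j) (c j) * v j  ≡⟨ cong (_* v j) (unit-diag (c j)) ⟩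
    1# * v j                ≡⟨ *-identityˡ _ ⟩
    v j                     ∎

  extend-outside : ∀ {k n} (c : Fin k → Fin n) v b → (∀ j → c j ≢ b) → extend c v b ≡ 0#
  extend-outside c v b b∉c = sum-zero _ (λ j → trans (cong (_* v j) (unit-off (c j) b (b∉c j ∘ sym))) (zeroˡ _))

  as-scaled-extend : ∀ {k n} (c : Fin k → Fin n) → Injective _≡_ _≡_ c → ∀ (f : Vector R n) a v →
    (∀ j → f (c j) ≡ a * v j) → (∀ b → (∀ j → c j ≢ b) → f b ≡ 0#) → ∀ b → f b ≡ a * extend c v b
  as-scaled-extend c c-inj f a v f∘c≡av f-outside b with any? (λ j → c j ≟ b)
  ... | yes (j , refl) = trans (f∘c≡av j) (cong (a *_) (sym (extend-image c c-inj v j)))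
  ... | no  b∉c = begin
    f b                 ≡⟨ f-outside b (λ j cj≡b → b∉c (j , cj≡b)) ⟩
    0#                  ≡⟨ zeroʳ a ⟨
    a * 0#              ≡⟨ cong (a *_) (extend-outside c v b (λ j cj≡b → b∉c (j , cj≡b))) ⟨
    a * extend c v b    ∎

  sum-image : ∀ {k n} (c : Fin k → Fin n) → Injective _≡_ _≡_ c → (f : Vector R n) →
    (∀ b → (∀ j → c j ≢ b) → f b ≡ 0#) → sum f ≡ sum (f ∘ c)
  sum-image c c-inj f f≡0 = begin
    sum f                                        ≡⟨ sum-cong-≗ fiber ⟨
    sum (λ b → sum (λ j → unit (c j) b * f b))  ≡⟨ ∑-comm (λ b j → unit (c j) b * f b) ⟩
    sum (λ j → sum (λ b → unit (c j) b * f b))  ≡⟨ sum-cong-≗ (λ j → sum-unit (c j) f) ⟩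
    sum (f ∘ c)                                  ∎
    where
    fiber : ∀ b → extend c (const (f b)) b ≡ f b
    fiber b with any? (λ j → c j ≟ b)
    ... | yes (j , refl) = extend-image c c-inj (const (f (c j))) j
    ... | no  b∉c        = trans (extend-outside c (const (f b)) b (λ j cj≡b → b∉c (j , cj≡b)))
                                 (sym (f≡0 b (λ j cj≡b → b∉c (j , cj≡b))))

  sum-extend : ∀ {k n} (c : Fin k → Fin n) → Injective _≡_ _≡_ c → ∀ v (g : Vector R n) →
    sum (λ b → g b * extend c v b) ≡ sum (λ j → g (c j) * v j)
  sum-extend c c-inj v g = begin
    sum (λ b → g b * extend c v b)
      ≡⟨ sum-image c c-inj _ (λ b b∉c → trans (cong (g b *_) (extend-outside c v b b∉c)) (zeroʳ _)) ⟩
    sum (λ j → g (c j) * extend c v (c j))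
      ≡⟨ sum-cong-≗ (λ j → cong (g (c j) *_) (extend-image c c-inj v j)) ⟩
    sum (λ j → g (c j) * v j) ∎

  sign : ∀ {k} → Fin k → R
  sign zero    = 1#
  sign (suc j) = - sign j

  sign-cancel : ∀ {k} (p : Fin k) {x y} → x ≡ sign p * y → y ≡ sign p * x
  sign-cancel p {x} {y} x≡±y = begin
    y                        ≡⟨ *-identityˡ y ⟨
    1# * y                   ≡⟨ cong (_* y) (sign*sign p) ⟨
    sign p * sign p * y      ≡⟨ *-assoc _ _ _ ⟩
    sign p * (sign p * y)    ≡⟨ cong (sign p *_) x≡±y ⟨
    sign p * x               ∎
    where
    sign*sign : ∀ {k} (j : Fin k) → sign j * sign j ≡ 1#
    sign*sign zero    = *-identityˡ 1#
    sign*sign (suc j) = begin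
      - sign j * - sign j    ≡⟨ -‿distribˡ-* _ _ ⟨
      - (sign j * - sign j)  ≡⟨ cong -_ (-‿distribʳ-* _ _) ⟨
      - - (sign j * sign j)  ≡⟨ ⁻¹-involutive _ ⟩
      sign j * sign j        ≡⟨ sign*sign j ⟩
      1#                     ∎

  minor : ∀ {m n} → Matrix R (suc m) (suc n) → Fin (suc m) → Fin (suc n) → Matrix R m n
  minor M i j r c = M (punchIn i r) (punchIn j c)

  det : ∀ k → Matrix R k k → R
  det zero    M = 1#
  det (suc k) M = sum (λ j → sign j * (M zero j * det k (minor M zero j)))

  det-cong : ∀ k {M N : Matrix R k k} → (∀ r c → M r c ≡ N r c) → det k M ≡ det k N
  det-cong zero    M≡N = refl
  det-cong (suc k) M≡N = sum-cong-≗ (λ j →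
    cong₂ (λ a d → sign j * (a * d)) (M≡N zero j) (det-cong k (λ r c → M≡N (suc r) (punchIn j c))))

  det-expand-first-column : ∀ k (M : Matrix R (suc k) (suc k)) →
    det (suc k) M ≡ sum (λ p → sign p * (M p zero * det k (minor M p zero)))
  det-expand-first-column zero    M = refl
  det-expand-first-column (suc k) M = cong (_+_ (1# * (M zero zero * det (suc k) (minor M zero zero)))) (begin
    sum (λ j → - sign j * (M zero (suc j) * det (suc k) (minor M zero (suc j))))
      ≡⟨ sum-cong-≗ (λ j → cong (λ d → - sign j * (M zero (suc j) * d))
                                  (det-expand-first-column k (minor M zero (suc j)))) ⟩
    sum (λ j → - sign j * (M zero (suc j) * sum (λ p → sign p * (M (suc p) zero * D p j))))
      ≡⟨ sum-cong-≗ (λ j → *-distribˡ-sum₂ (- sign j) (M zero (suc j)) (λ p → sign p * (M (suc p) zero * D p j))) ⟩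
    sum (λ j → sum (λ p → - sign j * (M zero (suc j) * (sign p * (M (suc p) zero * D p j)))))
      ≡⟨ ∑-comm (λ j p → - sign j * (M zero (suc j) * (sign p * (M (suc p) zero * D p j)))) ⟩
    sum (λ p → sum (λ j → - sign j * (M zero (suc j) * (sign p * (M (suc p) zero * D p j)))))
      ≡⟨ sum-cong-≗ (λ p → sum-cong-≗ (λ j →
           move-sign (sign j) (M zero (suc j)) (sign p) (M (suc p) zero) (D p j))) ⟩
    sum (λ p → sum (λ j → - sign p * (M (suc p) zero * (sign j * (M zero (suc j) * D p j)))))
      ≡⟨ sum-cong-≗ (λ p → *-distribˡ-sum₂ (- sign p) (M (suc p) zero) (λ j → sign j * (M zero (suc j) * D p j))) ⟨
    sum (λ p → - sign p * (M (suc p) zero * det (suc k) (minor M (suc p) zero))) ∎)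
    where
    D : Fin (suc k) → Fin (suc k) → R
    D p j = det k (λ r c → M (suc (punchIn p r)) (suc (punchIn j c)))
    *-distribˡ-sum₂ : ∀ {l} a b (f : Vector R l) → a * (b * sum f) ≡ sum (λ i → a * (b * f i))
    *-distribˡ-sum₂ a b f = trans (cong (a *_) (*-distribˡ-sum b f)) (*-distribˡ-sum a (λ i → b * f i))
    move-sign : ∀ x a y b d → - x * (a * (y * (b * d))) ≡ - y * (b * (x * (a * d)))
    move-sign x a y b d = begin
      - x * (a * (y * (b * d)))   ≡⟨ -‿distribˡ-* _ _ ⟨
      - (x * (a * (y * (b * d)))) ≡⟨ cong (λ e → - (x * e)) (*-exchange a y _) ⟩
      - (x * (y * (a * (b * d)))) ≡⟨ cong -_ (*-exchange x y _) ⟩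
      - (y * (x * (a * (b * d)))) ≡⟨ cong (λ e → - (y * (x * e))) (*-exchange a b d) ⟩
      - (y * (x * (b * (a * d)))) ≡⟨ cong (λ e → - (y * e)) (*-exchange x b _) ⟩
      - (y * (b * (x * (a * d)))) ≡⟨ -‿distribˡ-* _ _ ⟩
      - y * (b * (x * (a * d)))   ∎

  private
    lowerTerms : ∀ k → Matrix R (suc (suc k)) (suc (suc k)) → R
    lowerTerms k N = sum (λ p → sign (suc (suc p)) * (N (suc (suc p)) zero * det (suc k) (minor N (suc (suc p)) zero)))

    expand-top-two : ∀ k (N : Matrix R (suc (suc k)) (suc (suc k))) →
      det (suc (suc k)) N ≡ N zero zero * det (suc k) (minor N zero zero)
                            + (- (N (suc zero) zero * det (suc k) (minor N (suc zero) zero)) + lowerTerms k N)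
    expand-top-two k N = trans (det-expand-first-column (suc k) N)
      (cong₂ (λ a b → a + (b + lowerTerms k N)) (*-identityˡ _) (-1*x≈-x _))

  swap₀₁ : ∀ {k} → Fin (suc (suc k)) → Fin (suc (suc k))
  swap₀₁ zero          = suc zero
  swap₀₁ (suc zero)    = zero
  swap₀₁ (suc (suc i)) = suc (suc i)

  det-swap-first-rows : ∀ k (M : Matrix R (suc (suc k)) (suc (suc k))) →
    det (suc (suc k)) (M ∘ swap₀₁) ≡ - det (suc (suc k)) M
  det-swap-first-rows k M = begin
    det (suc (suc k)) (M ∘ swap₀₁)
      ≡⟨ expand-top-two k (M ∘ swap₀₁) ⟩
    M (suc zero) zero * det (suc k) (minor (M ∘ swap₀₁) zero zero)
      + (- (M zero zero * det (suc k) (minor (M ∘ swap₀₁) (suc zero) zero)) + lowerTerms k (M ∘ swap₀₁))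
      ≡⟨ cong₃ (λ d e t → M (suc zero) zero * d + (- (M zero zero * e) + t))
           (det-cong (suc k) (λ r c → cong (λ i → M i (suc c)) (swap-suc r)))
           (det-cong (suc k) (λ r c → cong (λ i → M i (suc c)) (swap-punchIn₁ r)))
           (lowerTerms-swap k M) ⟩
    Y + (- X + - T)      ≡⟨ +-exchange _ _ _ ⟩
    - X + (Y + - T)      ≡⟨ cong (λ y → - X + (y + - T)) (⁻¹-involutive Y) ⟨
    - X + (- - Y + - T)  ≡⟨ cong (_+_ (- X)) (⁻¹-∙-comm _ _) ⟩
    - X + - (- Y + T)    ≡⟨ ⁻¹-∙-comm _ _ ⟩
    - (X + (- Y + T))    ≡⟨ cong -_ (expand-top-two k M) ⟨
    - det (suc (suc k)) M ∎
    where
    X = M zero zero * det (suc k) (minor M zero zero)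
    Y = M (suc zero) zero * det (suc k) (minor M (suc zero) zero)
    T = lowerTerms k M
    cong₃ : ∀ {a b c d} (f : R → R → R → R) → a ≡ b → c ≡ d → ∀ {e g} → e ≡ g → f a c e ≡ f b d g
    cong₃ f refl refl refl = refl
    swap-suc : ∀ {k} (r : Fin (suc k)) → swap₀₁ (suc r) ≡ punchIn (suc zero) r
    swap-suc zero    = refl
    swap-suc (suc r) = refl
    swap-punchIn₁ : ∀ {k} (r : Fin (suc k)) → swap₀₁ (punchIn (suc zero) r) ≡ suc r
    swap-punchIn₁ zero    = refl
    swap-punchIn₁ (suc r) = refl
    swap-punchIn₂₊ : ∀ {k} (p : Fin (suc k)) (r : Fin (suc (suc k))) →
      swap₀₁ (punchIn (suc (suc p)) r) ≡ punchIn (suc (suc p)) (swap₀₁ r)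
    swap-punchIn₂₊ p zero          = refl
    swap-punchIn₂₊ p (suc zero)    = refl
    swap-punchIn₂₊ p (suc (suc r)) = refl
    lowerTerms-swap : ∀ k (M : Matrix R (suc (suc k)) (suc (suc k))) → lowerTerms k (M ∘ swap₀₁) ≡ - lowerTerms k M
    lowerTerms-swap zero    M = sym ε⁻¹≈ε
    lowerTerms-swap (suc k) M = trans (sum-cong-≗ (λ p → begin
        sign (suc (suc p)) * (M (suc (suc p)) zero * det (suc (suc k)) (minor (M ∘ swap₀₁) (suc (suc p)) zero))
          ≡⟨ cong (λ d → sign (suc (suc p)) * (M (suc (suc p)) zero * d))
               (trans (det-cong (suc (suc k)) (λ r c → cong (λ i → M i (suc c)) (swap-punchIn₂₊ p r)))
                      (det-swap-first-rows k (minor M (suc (suc p)) zero))) ⟩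
        sign (suc (suc p)) * (M (suc (suc p)) zero * - det (suc (suc k)) (minor M (suc (suc p)) zero))
          ≡⟨ trans (-‿distribʳ-* _ _) (cong (sign (suc (suc p)) *_) (-‿distribʳ-* _ _)) ⟨
        - (sign (suc (suc p)) * (M (suc (suc p)) zero * det (suc (suc k)) (minor M (suc (suc p)) zero))) ∎))
      (sum-neg (λ p → sign (suc (suc p)) * (M (suc (suc p)) zero * det (suc (suc k)) (minor M (suc (suc p)) zero))))

  det-equal-first-rows : ∀ k (M : Matrix R (suc (suc k)) (suc (suc k))) →
    (∀ c → M zero c ≡ M (suc zero) c) → det (suc (suc k)) M ≡ 0#
  det-equal-first-rows k M M₀≡M₁ = begin
    det (suc (suc k)) M
      ≡⟨ expand-top-two k M ⟩
    M zero zero * det (suc k) (minor M zero zero)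
      + (- (M (suc zero) zero * det (suc k) (minor M (suc zero) zero)) + lowerTerms k M)
      ≡⟨ cong₂ (λ e t → M zero zero * det (suc k) (minor M zero zero) + (- e + t))
           (cong₂ _*_ (sym (M₀≡M₁ zero)) (det-cong (suc k) minor₁≡minor₀)) (lowerTerms-zero k M M₀≡M₁) ⟩
    X + (- X + 0#)  ≡⟨ cong (_+_ X) (+-identityʳ _) ⟩
    X + - X         ≡⟨ -‿inverseʳ X ⟩
    0#              ∎
    where
    X = M zero zero * det (suc k) (minor M zero zero)
    minor₁≡minor₀ : ∀ r c → minor M (suc zero) zero r c ≡ minor M zero zero r c
    minor₁≡minor₀ zero    c = M₀≡M₁ (suc c)
    minor₁≡minor₀ (suc r) c = refl
    lowerTerms-zero : ∀ k (M : Matrix R (suc (suc k)) (suc (suc k))) →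
      (∀ c → M zero c ≡ M (suc zero) c) → lowerTerms k M ≡ 0#
    lowerTerms-zero zero    M M₀≡M₁ = refl
    lowerTerms-zero (suc k) M M₀≡M₁ = sum-zero _ (λ p → begin
      sign (suc (suc p)) * (M (suc (suc p)) zero * det (suc (suc k)) (minor M (suc (suc p)) zero))
        ≡⟨ cong (λ d → sign (suc (suc p)) * (M (suc (suc p)) zero * d))
             (det-equal-first-rows k (minor M (suc (suc p)) zero) (M₀≡M₁ ∘ suc)) ⟩
      sign (suc (suc p)) * (M (suc (suc p)) zero * 0#)
        ≡⟨ trans (cong (sign (suc (suc p)) *_) (zeroʳ _)) (zeroʳ _) ⟩
      0# ∎)

  det-lift : ∀ k (σ : Fin k → Fin k) (ε : R) → (∀ N → det k (N ∘ σ) ≡ ε * det k N) →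
    ∀ M → det (suc k) (M ∘ Fin.lift 1 σ) ≡ ε * det (suc k) M
  det-lift k σ ε det-σ M = begin
    sum (λ j → sign j * (M zero j * det k (minor M zero j ∘ σ)))
      ≡⟨ sum-cong-≗ (λ j → cong (λ d → sign j * (M zero j * d)) (det-σ (minor M zero j))) ⟩
    sum (λ j → sign j * (M zero j * (ε * det k (minor M zero j))))
      ≡⟨ sum-cong-≗ (λ j → trans (cong (sign j *_) (*-exchange (M zero j) ε (det k (minor M zero j)))) (*-exchange (sign j) ε _)) ⟩
    sum (λ j → ε * (sign j * (M zero j * det k (minor M zero j))))
      ≡⟨ *-distribˡ-sum ε (λ j → sign j * (M zero j * det k (minor M zero j))) ⟨
    ε * det (suc k) M ∎

  bringToTop : ∀ {k} → Fin (suc k) → Fin (suc k) → Fin (suc k)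
  bringToTop p zero    = p
  bringToTop p (suc i) = punchIn p i

  det-bringToTop : ∀ k (p : Fin (suc k)) (M : Matrix R (suc k) (suc k)) →
    det (suc k) (M ∘ bringToTop p) ≡ sign p * det (suc k) M
  det-bringToTop k zero M =
    trans (det-cong (suc k) (λ r c → cong (λ i → M i c) (bringToTop₀ r))) (sym (*-identityˡ _))
    where
    bringToTop₀ : ∀ {k} (r : Fin (suc k)) → bringToTop zero r ≡ r
    bringToTop₀ zero    = refl
    bringToTop₀ (suc r) = refl
  det-bringToTop (suc k) (suc p) M = begin
    det (suc (suc k)) (M ∘ bringToTop (suc p))
      ≡⟨ det-cong (suc (suc k)) (λ r c → cong (λ i → M i c) (bringToTop-suc r)) ⟩
    det (suc (suc k)) (M ∘ Fin.lift 1 (bringToTop p) ∘ swap₀₁)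
      ≡⟨ det-swap-first-rows k (M ∘ Fin.lift 1 (bringToTop p)) ⟩
    - det (suc (suc k)) (M ∘ Fin.lift 1 (bringToTop p))
      ≡⟨ cong -_ (det-lift (suc k) (bringToTop p) (sign p) (det-bringToTop k p) M) ⟩
    - (sign p * det (suc (suc k)) M)
      ≡⟨ -‿distribˡ-* _ _ ⟩
    - sign p * det (suc (suc k)) M ∎
    where
    bringToTop-suc : ∀ r → bringToTop (suc p) r ≡ Fin.lift 1 (bringToTop p) (swap₀₁ r)
    bringToTop-suc zero          = refl
    bringToTop-suc (suc zero)    = refl
    bringToTop-suc (suc (suc r)) = refl

  det-expand-row : ∀ k (p : Fin (suc k)) (M : Matrix R (suc k) (suc k)) →
    det (suc k) M ≡ sign p * sum (λ j → sign j * (M p j * det k (minor M p j)))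
  det-expand-row k p M = sign-cancel p (det-bringToTop k p M)

  det-equal-rows : ∀ k (M : Matrix R k k) (p q : Fin k) → p ≢ q → (∀ c → M p c ≡ M q c) → det k M ≡ 0#
  det-equal-rows (suc zero)    M zero zero p≢q _ = ⊥-elim (p≢q refl)
  det-equal-rows (suc (suc k)) M p q p≢q Mp≡Mq = begin
    det (suc (suc k)) M
      ≡⟨ sign-cancel q (det-bringToTop (suc k) q M) ⟩
    sign q * det (suc (suc k)) N
      ≡⟨ cong (sign q *_) (sign-cancel a (det-lift (suc k) (bringToTop a) (sign a) (det-bringToTop k a) N)) ⟩
    sign q * (sign a * det (suc (suc k)) (N ∘ Fin.lift 1 (bringToTop a)))
      ≡⟨ cong (λ d → sign q * (sign a * d)) (det-equal-first-rows k (N ∘ Fin.lift 1 (bringToTop a)) N₀≡Nₐ) ⟩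
    sign q * (sign a * 0#)
      ≡⟨ trans (cong (sign q *_) (zeroʳ _)) (zeroʳ _) ⟩
    0# ∎
    where
    N = M ∘ bringToTop q
    q≢p : q ≢ p
    q≢p = p≢q ∘ sym
    a = punchOut q≢p
    N₀≡Nₐ : ∀ c → M q c ≡ M (punchIn q a) c
    N₀≡Nₐ c = trans (sym (Mp≡Mq c)) (cong (λ i → M i c) (sym (punchIn-punchOut q≢p)))

  det-transpose : ∀ k (M : Matrix R k k) → det k (λ r c → M c r) ≡ det k M
  det-transpose zero    M = refl
  det-transpose (suc k) M = trans
    (sum-cong-≗ (λ j → cong (λ d → sign j * (M j zero * d)) (det-transpose k (minor M j zero))))
    (sym (det-expand-first-column k M))

  replaceRow : ∀ {k} → Matrix R k k → Fin k → Vector R k → Matrix R k k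
  replaceRow M t u = updateAt M t (const u)

  det-replaceRow-expand : ∀ k (M : Matrix R (suc k) (suc k)) t u →
    det (suc k) (replaceRow M t u) ≡ sign t * sum (λ l → sign l * (u l * det k (minor M t l)))
  det-replaceRow-expand k M t u = trans (det-expand-row k t (replaceRow M t u))
    (cong (sign t *_) (sum-cong-≗ (λ l → cong₂ (λ a d → sign l * (a * d))
      (cong-app (updateAt-updates t {const u} M) l)
      (det-cong k (λ r c → cong-app (updateAt-minimal (punchIn t r) t {const u} M (punchInᵢ≢i t r)) (punchIn l c))))))

  det-replaceRow-linear : ∀ k {s} (M : Matrix R (suc k) (suc k)) t (q : Vector R s) (V : Matrix R s (suc k)) →
    det (suc k) (replaceRow M t (λ l → sum (λ b → q b * V b l)))
      ≡ sum (λ b → q b * det (suc k) (replaceRow M t (V b)))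
  det-replaceRow-linear k M t q V = begin
    det (suc k) (replaceRow M t (λ l → sum (λ b → q b * V b l)))
      ≡⟨ det-replaceRow-expand k M t _ ⟩
    sign t * sum (λ l → sign l * (sum (λ b → q b * V b l) * C l))
      ≡⟨ cong (sign t *_) (sum-cong-≗ (λ l → trans (cong (sign l *_) (*-distribʳ-sum (C l) (λ b → q b * V b l)))
                                                   (*-distribˡ-sum (sign l) (λ b → q b * V b l * C l)))) ⟩
    sign t * sum (λ l → sum (λ b → sign l * (q b * V b l * C l)))
      ≡⟨ cong (sign t *_) (∑-comm (λ l b → sign l * (q b * V b l * C l))) ⟩
    sign t * sum (λ b → sum (λ l → sign l * (q b * V b l * C l)))
      ≡⟨ cong (sign t *_) (sum-cong-≗ (λ b → trans (sum-cong-≗ (λ l → factor-out (sign l) (q b) (V b l) (C l)))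
                                                   (sym (*-distribˡ-sum (q b) (λ l → sign l * (V b l * C l)))))) ⟩
    sign t * sum (λ b → q b * sum (λ l → sign l * (V b l * C l)))
      ≡⟨ *-distribˡ-sum (sign t) (λ b → q b * sum (λ l → sign l * (V b l * C l))) ⟩
    sum (λ b → sign t * (q b * sum (λ l → sign l * (V b l * C l))))
      ≡⟨ sum-cong-≗ (λ b → trans (*-exchange _ _ _) (cong (q b *_) (sym (det-replaceRow-expand k M t (V b))))) ⟩
    sum (λ b → q b * det (suc k) (replaceRow M t (V b))) ∎
    where
    C : Fin (suc k) → R
    C l = det k (minor M t l)
    factor-out : ∀ s a b c → s * (a * b * c) ≡ a * (s * (b * c))
    factor-out s a b c = trans (cong (s *_) (*-assoc a b c)) (*-exchange s a _)

  det-replaceRow-combination : ∀ k (M : Matrix R (suc k) (suc k)) t (q : Vector R (suc k)) →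
    det (suc k) (replaceRow M t (λ l → sum (λ b → q b * M b l))) ≡ q t * det (suc k) M
  det-replaceRow-combination k M t q = begin
    det (suc k) (replaceRow M t (λ l → sum (λ b → q b * M b l)))
      ≡⟨ det-replaceRow-linear k M t q M ⟩
    sum (λ b → q b * det (suc k) (replaceRow M t (M b)))
      ≡⟨ sum-single t (λ b → q b * det (suc k) (replaceRow M t (M b))) repeated-row ⟩
    q t * det (suc k) (replaceRow M t (M t))
      ≡⟨ cong (q t *_) (det-cong (suc k) (λ r → cong-app (updateAt-id-local t {const (M t)} M refl r))) ⟩
    q t * det (suc k) M ∎
    where
    repeated-row : ∀ b → b ≢ t → q b * det (suc k) (replaceRow M t (M b)) ≡ 0#
    repeated-row b b≢t =
      trans (cong (q b *_) (det-equal-rows (suc k) (replaceRow M t (M b)) t b (b≢t ∘ sym) rows-t≡b)) (zeroʳ _)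
      where
      rows-t≡b : ∀ c → replaceRow M t (M b) t c ≡ replaceRow M t (M b) b c
      rows-t≡b c = trans (cong-app (updateAt-updates t {const (M b)} M) c)
                         (sym (cong-app (updateAt-minimal b t {const (M b)} M b≢t) c))

  cofactors : ∀ {k} → Matrix R k (suc k) → Vector R (suc k)
  cofactors {k} B j = sign j * det k (λ r c → B r (punchIn j c))

  det-∷ : ∀ {k} (u : Vector R (suc k)) (B : Matrix R k (suc k)) →
    det (suc k) (u ∷ B) ≡ sum (λ j → u j * cofactors B j)
  det-∷ {k} u B = sum-cong-≗ (λ j → *-exchange (sign j) (u j) (det k (λ r c → B r (punchIn j c))))

  cofactors-orthogonal : ∀ {k} (B : Matrix R k (suc k)) a → (B *ᵥ cofactors B) a ≡ 0#
  cofactors-orthogonal {k} B a =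
    trans (sym (det-∷ (B a) B)) (det-equal-rows (suc k) (B a ∷ B) zero (suc a) (λ ()) (λ c → refl))

  -- Cramer's rule: replace row j of [eᵢ; B]ᵀ by the combination of its rows with coefficients q,
  -- and expand the determinant once by multilinearity and once along row j.
  kernel-∝-cofactors : ∀ {k} (B : Matrix R k (suc k)) (q : Vector R (suc k)) →
    (∀ a → (B *ᵥ q) a ≡ 0#) → ∀ i j → q j * cofactors B i ≡ q i * cofactors B j
  kernel-∝-cofactors {k} B q Bq≡0 i j = begin
    q j * cofactors B i
      ≡⟨ cong (q j *_) (sym (trans (det-transpose (suc k) N) (trans (det-∷ (unit i) B) (sum-unit i (cofactors B))))) ⟩
    q j * det (suc k) Nᵀ
      ≡⟨ det-replaceRow-combination k Nᵀ j q ⟨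
    det (suc k) (replaceRow Nᵀ j Nq)
      ≡⟨ det-replaceRow-expand k Nᵀ j Nq ⟩
    sign j * sum (λ l → sign l * (Nq l * det k (minor Nᵀ j l)))
      ≡⟨ cong (sign j *_) (sum-single zero _ Nq-off-head) ⟩
    sign j * (1# * (Nq zero * det k (minor Nᵀ j zero)))
      ≡⟨ cong (λ d → sign j * d) (*-identityˡ _) ⟩
    sign j * (Nq zero * det k (minor Nᵀ j zero))
      ≡⟨ cong₂ (λ a d → sign j * (a * d)) Nq-head (det-transpose k (λ r c → B r (punchIn j c))) ⟩
    sign j * (q i * det k (λ r c → B r (punchIn j c)))
      ≡⟨ *-exchange _ _ _ ⟩
    q i * cofactors B j ∎
    where
    N : Matrix R (suc k) (suc k)
    N = unit i ∷ B
    Nᵀ : Matrix R (suc k) (suc k)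
    Nᵀ r c = N c r
    Nq : Vector R (suc k)
    Nq l = sum (λ b → q b * Nᵀ b l)
    Nq-head : Nq zero ≡ q i
    Nq-head = trans (sum-cong-≗ (λ b → *-comm (q b) (unit i b))) (sum-unit i q)
    Nq-off-head : ∀ l → l ≢ zero → sign l * (Nq l * det k (minor Nᵀ j l)) ≡ 0#
    Nq-off-head zero    l≢0 = ⊥-elim (l≢0 refl)
    Nq-off-head (suc a) _   = begin
      sign (suc a) * (Nq (suc a) * det k (minor Nᵀ j (suc a)))
        ≡⟨ cong (λ x → sign (suc a) * (x * det k (minor Nᵀ j (suc a))))
             (trans (sum-cong-≗ (λ b → *-comm (q b) (B a b))) (Bq≡0 a)) ⟩
      sign (suc a) * (0# * det k (minor Nᵀ j (suc a)))
        ≡⟨ trans (cong (sign (suc a) *_) (zeroˡ _)) (zeroʳ _) ⟩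
      0# ∎

  module _ (_≟ᴿ_ : DecidableEquality R) (1≢0 : 1# ≢ 0#) where

    -- Induction on the columns: if no row extends the nonsingular minor found for the last s
    -- columns, its cofactor vector is a nonzero kernel vector of B.
    trivialKernel⇒nonsingularRows : ∀ {r} s (B : Matrix R r s) →
      (∀ (u : Vector R s) → (∀ a → (B *ᵥ u) a ≡ 0#) → ∀ b → u b ≡ 0#) →
      Σ (Fin s → Fin r) λ ρ → Injective _≡_ _≡_ ρ × det s (B ∘ ρ) ≢ 0#
    trivialKernel⇒nonsingularRows zero    B _ = (λ ()) , (λ { {()} }) , 1≢0
    trivialKernel⇒nonsingularRows (suc s) B ker≡0
      with trivialKernel⇒nonsingularRows s (λ a b → B a (suc b)) tail-ker≡0
      where
      tail-ker≡0 : ∀ (u : Vector R s) → (∀ a → ((λ a b → B a (suc b)) *ᵥ u) a ≡ 0#) → ∀ b → u b ≡ 0#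
      tail-ker≡0 u Bu≡0 b = ker≡0 (0# ∷ u) (λ a → trans (cong₂ _+_ (zeroʳ _) (Bu≡0 a)) (+-identityˡ 0#)) (suc b)
    ... | ρ , ρ-inj , detρ≢0 with any? (λ i → ¬? (det (suc s) (B ∘ (i ∷ ρ)) ≟ᴿ 0#))
    ...   | yes (i , det≢0) = i ∷ ρ , ∷-inj , det≢0
      where
      row-clash : ∀ a → i ≡ ρ a → det (suc s) (B ∘ (i ∷ ρ)) ≡ 0#
      row-clash a i≡ρa = det-equal-rows (suc s) (B ∘ (i ∷ ρ)) zero (suc a) (λ ()) (λ c → cong (λ x → B x c) i≡ρa)
      ∷-inj : Injective _≡_ _≡_ (i ∷ ρ)
      ∷-inj {zero}  {zero}  _  = refl
      ∷-inj {zero}  {suc b} eq = ⊥-elim (det≢0 (row-clash b eq))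
      ∷-inj {suc a} {zero}  eq = ⊥-elim (det≢0 (row-clash a (sym eq)))
      ∷-inj {suc a} {suc b} eq = cong suc (ρ-inj eq)
    ...   | no  all≡0 = ⊥-elim (detρ≢0 (trans (sym (*-identityˡ _)) (ker≡0 u Bu≡0 zero)))
      where
      u : Vector R (suc s)
      u = cofactors (B ∘ ρ)
      Bu≡0 : ∀ a → (B *ᵥ u) a ≡ 0#
      Bu≡0 a with det (suc s) (B ∘ (a ∷ ρ)) ≟ᴿ 0#
      ... | yes det≡0 = trans (sym (det-∷ (B a) (B ∘ ρ))) det≡0
      ... | no  det≢0 = ⊥-elim (all≡0 (a , det≢0))

-- Integer matrices and their images over ℚ

open import Defs hiding (Matrix)

module ℤᴰ = Determinant ℤP.+-*-isCommutativeRing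
module ℚᴰ = Determinant ℚP.+-*-isCommutativeRing

sumℤ≡ℤsum : ∀ {k} (f : Vector ℤ k) → sumℤ f ≡ ℤᴰ.sum f
sumℤ≡ℤsum {zero}  f = refl
sumℤ≡ℤsum {suc k} f = cong (ℤ._+_ (f zero)) (sumℤ≡ℤsum (f ∘ suc))

sumℚ≡ℚsum : ∀ {k} (f : Vector ℚ k) → sumℚ f ≡ ℚᴰ.sum f
sumℚ≡ℚsum {zero}  f = refl
sumℚ≡ℚsum {suc k} f = cong (f zero ℚ.+_) (sumℚ≡ℚsum (f ∘ suc))

det≡ℤdet : ∀ k (M : Matrix ℤ k k) → det k M ≡ ℤᴰ.det k M
det≡ℤdet zero    M = refl
det≡ℤdet (suc k) M =
  trans (sumℤ≡ℤsum (λ j → signFin j ℤ.* (M zero j ℤ.* det k (ℤᴰ.minor M zero j))))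
        (ℤᴰ.sum-cong-≗ (λ j → cong₂ (λ s d → s ℤ.* (M zero j ℤ.* d)) (signFin≡ℤsign j) (det≡ℤdet k (ℤᴰ.minor M zero j))))
  where
  signFin≡ℤsign : ∀ {k} (j : Fin k) → signFin j ≡ ℤᴰ.sign j
  signFin≡ℤsign zero    = refl
  signFin≡ℤsign (suc j) = cong ℤ.-_ (signFin≡ℤsign j)

-- z / 1 is already in normal form, and in this shape ℚ's operations on it compute definitionally.
toℚ≡mkℚ : ∀ z → toℚ z ≡ mkℚ z 0 (Coprime.sym (Coprime.1-coprimeTo ∣ z ∣))
toℚ≡mkℚ z = ℚP.↥p/↧p≡p (mkℚ z 0 _)

toℚ-injective : ∀ {a b} → toℚ a ≡ toℚ b → a ≡ b
toℚ-injective {a} {b} eq = cong ℚ.↥_ (trans (sym (toℚ≡mkℚ a)) (trans eq (toℚ≡mkℚ b)))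

toℚ-+ : ∀ a b → toℚ (a ℤ.+ b) ≡ toℚ a ℚ.+ toℚ b
toℚ-+ a b = trans (cong toℚ (sym (cong₂ ℤ._+_ (ℤP.*-identityʳ a) (ℤP.*-identityʳ b))))
                  (sym (cong₂ ℚ._+_ (toℚ≡mkℚ a) (toℚ≡mkℚ b)))

toℚ-* : ∀ a b → toℚ (a ℤ.* b) ≡ toℚ a ℚ.* toℚ b
toℚ-* a b = sym (cong₂ ℚ._*_ (toℚ≡mkℚ a) (toℚ≡mkℚ b))

toℚ-neg : ∀ a → toℚ (ℤ.- a) ≡ ℚ.- toℚ a
toℚ-neg a = trans (toℚ≡mkℚ (ℤ.- a)) (trans (neg-mkℚ a) (sym (cong ℚ.-_ (toℚ≡mkℚ a))))
  where
  neg-mkℚ : ∀ a → mkℚ (ℤ.- a) 0 (Coprime.sym (Coprime.1-coprimeTo ∣ ℤ.- a ∣))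
                ≡ ℚ.- mkℚ a 0 (Coprime.sym (Coprime.1-coprimeTo ∣ a ∣))
  neg-mkℚ (+ zero)   = refl
  neg-mkℚ +[1+ n ]   = refl
  neg-mkℚ -[1+ n ]   = refl

toℚ-sum : ∀ {k} (f : Vector ℤ k) → toℚ (ℤᴰ.sum f) ≡ ℚᴰ.sum (toℚ ∘ f)
toℚ-sum {zero}  f = refl
toℚ-sum {suc k} f = trans (toℚ-+ (f zero) _) (cong (toℚ (f zero) ℚ.+_) (toℚ-sum (f ∘ suc)))

toℚ-*ᵥ : ∀ {m n} (M : Matrix ℤ m n) (v : Vector ℤ n) i →
  toℚ ((M ℤᴰ.*ᵥ v) i) ≡ ((λ r c → toℚ (M r c)) ℚᴰ.*ᵥ toℚ ∘ v) i
toℚ-*ᵥ M v i = trans (toℚ-sum (λ j → M i j ℤ.* v j)) (ℚᴰ.sum-cong-≗ (λ j → toℚ-* (M i j) (v j)))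

toℚ-sign : ∀ {k} (j : Fin k) → toℚ (ℤᴰ.sign j) ≡ ℚᴰ.sign j
toℚ-sign zero    = refl
toℚ-sign (suc j) = trans (toℚ-neg (ℤᴰ.sign j)) (cong ℚ.-_ (toℚ-sign j))

toℚ-det : ∀ k (M : Matrix ℤ k k) → toℚ (ℤᴰ.det k M) ≡ ℚᴰ.det k (λ r c → toℚ (M r c))
toℚ-det zero    M = refl
toℚ-det (suc k) M =
  trans (toℚ-sum (λ j → ℤᴰ.sign j ℤ.* (M zero j ℤ.* ℤᴰ.det k (ℤᴰ.minor M zero j)))) (ℚᴰ.sum-cong-≗ term)
  where
  open ≡-Reasoning
  term : ∀ j → toℚ (ℤᴰ.sign j ℤ.* (M zero j ℤ.* ℤᴰ.det k (ℤᴰ.minor M zero j)))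
             ≡ ℚᴰ.sign j ℚ.* (toℚ (M zero j) ℚ.* ℚᴰ.det k (ℚᴰ.minor (λ r c → toℚ (M r c)) zero j))
  term j = begin
    toℚ (ℤᴰ.sign j ℤ.* (M zero j ℤ.* ℤᴰ.det k (ℤᴰ.minor M zero j)))
      ≡⟨ trans (toℚ-* (ℤᴰ.sign j) _) (cong (toℚ (ℤᴰ.sign j) ℚ.*_) (toℚ-* (M zero j) _)) ⟩
    toℚ (ℤᴰ.sign j) ℚ.* (toℚ (M zero j) ℚ.* toℚ (ℤᴰ.det k (ℤᴰ.minor M zero j)))
      ≡⟨ cong₂ (λ s d → s ℚ.* (toℚ (M zero j) ℚ.* d)) (toℚ-sign j) (toℚ-det k (ℤᴰ.minor M zero j)) ⟩
    ℚᴰ.sign j ℚ.* (toℚ (M zero j) ℚ.* ℚᴰ.det k (ℚᴰ.minor (λ r c → toℚ (M r c)) zero j)) ∎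

toℚ-cofactors : ∀ {k} (B : Matrix ℤ k (suc k)) j → toℚ (ℤᴰ.cofactors B j) ≡ ℚᴰ.cofactors (λ r c → toℚ (B r c)) j
toℚ-cofactors {k} B j =
  trans (toℚ-* (ℤᴰ.sign j) _) (cong₂ ℚ._*_ (toℚ-sign j) (toℚ-det k (λ r c → B r (punchIn j c))))

ℚ-*-cancelˡ-≡0 : ∀ {p q} → p ≢ 0ℚ → p ℚ.* q ≡ 0ℚ → q ≡ 0ℚ
ℚ-*-cancelˡ-≡0 {p} {q} p≢0 pq≡0 = begin
  q                   ≡⟨ ℚP.*-identityˡ q ⟨
  1ℚ ℚ.* q            ≡⟨ cong (ℚ._* q) (ℚP.*-inverseˡ p) ⟨
  ℚ.1/ p ℚ.* p ℚ.* q  ≡⟨ ℚP.*-assoc (ℚ.1/ p) p q ⟩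
  ℚ.1/ p ℚ.* (p ℚ.* q) ≡⟨ cong (ℚ.1/ p ℚ.*_) pq≡0 ⟩
  ℚ.1/ p ℚ.* 0ℚ       ≡⟨ ℚP.*-zeroʳ (ℚ.1/ p) ⟩
  0ℚ                  ∎
  where
  open ≡-Reasoning
  instance
    p-nonZero : ℚ.NonZero p
    p-nonZero = ℚ.≢-nonZero p≢0

gcdVec≡1⇒∣factor∣≡1 : ∀ {k} {z u : Vector ℤ k} s → (∀ t → z t ≡ s ℤ.* u t) → gcdVec z ≡ 1 → ∣ s ∣ ≡ 1
gcdVec≡1⇒∣factor∣≡1 {z = z} {u} s z≡su gcd≡1 =
  ∣1⇒≡1 (subst (∣ s ∣ ∣_) gcd≡1 (∣-gcdVec z (λ t → subst (∣ s ∣ ∣_) (sym (∣z∣≡∣s∣*∣u∣ t)) (m∣m*n _))))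
  where
  ∣z∣≡∣s∣*∣u∣ : ∀ t → ∣ z t ∣ ≡ ∣ s ∣ ℕ.* ∣ u t ∣
  ∣z∣≡∣s∣*∣u∣ t = trans (cong ∣_∣ (z≡su t)) (ℤP.abs-* s (u t))
  ∣-gcdVec : ∀ {k} (x : Vector ℤ k) {d} → (∀ t → d ∣ ∣ x t ∣) → d ∣ gcdVec x
  ∣-gcdVec {zero}  x {d} _ = d ∣0
  ∣-gcdVec {suc k} x d∣x = gcd-greatest (d∣x zero) (∣-gcdVec (x ∘ suc) (d∣x ∘ suc))

gcdVec-∣ : ∀ {k} (x : Vector ℤ k) t → gcdVec x ∣ ∣ x t ∣
gcdVec-∣ x zero    = gcd[m,n]∣m ∣ x zero ∣ (gcdVec (x ∘ suc))
gcdVec-∣ x (suc t) = ∣-trans (gcd[m,n]∣n ∣ x zero ∣ (gcdVec (x ∘ suc))) (gcdVec-∣ (x ∘ suc) t)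

∣x∣≤1⇒∣x∣≡1 : ∀ x → ∣ x ∣ ℕ.≤ 1 → x ≢ + 0 → ∣ x ∣ ≡ 1
∣x∣≤1⇒∣x∣≡1 (+ zero)   _  x≢0 = ⊥-elim (x≢0 refl)
∣x∣≤1⇒∣x∣≡1 +[1+ zero ] _  _   = refl
∣x∣≤1⇒∣x∣≡1 -[1+ zero ] _  _   = refl
∣x∣≤1⇒∣x∣≡1 +[1+ suc n ] (ℕ.s≤s ()) _
∣x∣≤1⇒∣x∣≡1 -[1+ suc n ] (ℕ.s≤s ()) _

∣x∣≡1⇒x*x≡1 : ∀ x → ∣ x ∣ ≡ 1 → x ℤ.* x ≡ + 1
∣x∣≡1⇒x*x≡1 +[1+ zero ] _ = refl
∣x∣≡1⇒x*x≡1 -[1+ zero ] _ = refl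

∣unit*x∣≡∣x∣ : ∀ s x → ∣ s ∣ ≡ 1 → ∣ s ℤ.* x ∣ ≡ ∣ x ∣
∣unit*x∣≡∣x∣ s x ∣s∣≡1 = trans (ℤP.abs-* s x) (trans (cong (ℕ._* ∣ x ∣) ∣s∣≡1) (ℕP.*-identityˡ ∣ x ∣))

∣sign∣≡1 : ∀ {k} (j : Fin k) → ∣ ℤᴰ.sign j ∣ ≡ 1
∣sign∣≡1 zero    = refl
∣sign∣≡1 (suc j) = trans (ℤP.∣-i∣≡∣i∣ (ℤᴰ.sign j)) (∣sign∣≡1 j)

-- Circuits of [A I]

circuit-minimal : ∀ {m n} {M : Matrix ℤ m n} {z} → IsCircuit M z → ∀ q → InKerℚ M q →
  (∀ t → z t ≡ + 0 → q t ≡ 0ℚ) → ∀ t → z t ≢ + 0 → q t ≡ 0ℚ → ∀ t′ → q t′ ≡ 0ℚ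
circuit-minimal (_ , _ , _ , minimal) q ker supp⊆ t zt≢0 qt≡0 t′ with q t′ ℚP.≟ 0ℚ
... | yes qt′≡0 = qt′≡0
... | no  qt′≢0 =
  ⊥-elim (minimal q ker (t′ , qt′≢0) (λ s qs≢0 zs≡0 → qs≢0 (supp⊆ s zs≡0)) t zt≢0 qt≡0)

module SlackForm {m n} (A : Matrix ℤ m n) where

  open ≡-Reasoning

  Aℚ : Matrix ℚ m n
  Aℚ i j = toℚ (A i j)

  xPart : ∀ {X : Set} → Vector X (n ℕ.+ m) → Vector X n
  xPart z b = z (b ↑ˡ m)

  yPart : ∀ {X : Set} → Vector X (n ℕ.+ m) → Vector X m
  yPart z l = z (n ↑ʳ l)

  appendId-row : ∀ (q : Vector ℚ (n ℕ.+ m)) i →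
    sumℚ (λ t → toℚ (appendId A i t) ℚ.* q t) ≡ (Aℚ ℚᴰ.*ᵥ xPart q) i ℚ.+ yPart q i
  appendId-row q i = begin
    sumℚ (λ t → toℚ (appendId A i t) ℚ.* q t)
      ≡⟨ trans (sumℚ≡ℚsum (λ t → toℚ (appendId A i t) ℚ.* q t))
               (ℚᴰ.sum-splitAt n (λ t → toℚ (appendId A i t) ℚ.* q t)) ⟩
    ℚᴰ.sum (λ b → toℚ (appendId A i (b ↑ˡ m)) ℚ.* q (b ↑ˡ m))
      ℚ.+ ℚᴰ.sum (λ l → toℚ (appendId A i (n ↑ʳ l)) ℚ.* q (n ↑ʳ l))
      ≡⟨ cong₂ ℚ._+_ (ℚᴰ.sum-cong-≗ (λ b → cong (λ a → toℚ a ℚ.* q (b ↑ˡ m)) (appendId-↑ˡ b)))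
                     (trans (ℚᴰ.sum-cong-≗ (λ l → cong (ℚ._* q (n ↑ʳ l)) (appendId-↑ʳ l))) (ℚᴰ.sum-unit i (yPart q))) ⟩
    (Aℚ ℚᴰ.*ᵥ xPart q) i ℚ.+ yPart q i ∎
    where
    appendId-↑ˡ : ∀ b → appendId A i (b ↑ˡ m) ≡ A i b
    appendId-↑ˡ b rewrite splitAt-↑ˡ n b m = refl
    appendId-↑ʳ : ∀ l → toℚ (appendId A i (n ↑ʳ l)) ≡ ℚᴰ.unit i l
    appendId-↑ʳ l rewrite splitAt-↑ʳ n m l with i ≟ l | l ≟ i
    ... | yes _   | yes _   = refl
    ... | no  _   | no  _   = refl
    ... | yes i≡l | no  l≢i = ⊥-elim (l≢i (sym i≡l))
    ... | no  i≢l | yes l≡i = ⊥-elim (i≢l (sym l≡i))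

  kernel-yPart : ∀ {q} → InKerℚ (appendId A) q → ∀ i → yPart q i ≡ ℚ.- (Aℚ ℚᴰ.*ᵥ xPart q) i
  kernel-yPart {q} ker i = ℚᴰ.inverseʳ-unique _ _ (trans (sym (appendId-row q i)) (ker i))

  kernel-yPartℤ : ∀ {z} → InKerℚ (appendId A) (toℚ ∘ z) → ∀ i → yPart z i ≡ ℤ.- (A ℤᴰ.*ᵥ xPart z) i
  kernel-yPartℤ {z} ker i = toℚ-injective (begin
    toℚ (yPart z i)                        ≡⟨ kernel-yPart ker i ⟩
    ℚ.- (Aℚ ℚᴰ.*ᵥ toℚ ∘ xPart z) i        ≡⟨ cong ℚ.-_ (toℚ-*ᵥ A (xPart z) i) ⟨
    ℚ.- toℚ ((A ℤᴰ.*ᵥ xPart z) i)         ≡⟨ toℚ-neg ((A ℤᴰ.*ᵥ xPart z) i) ⟨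
    toℚ (ℤ.- (A ℤᴰ.*ᵥ xPart z) i)         ∎)

  withSlacks : Vector ℤ n → Vector ℤ (n ℕ.+ m)
  withSlacks x = x ++ (λ i → ℤ.- (A ℤᴰ.*ᵥ x) i)

  xPart-withSlacks : ∀ x b → xPart (withSlacks x) b ≡ x b
  xPart-withSlacks x = lookup-++ˡ x _

  yPart-withSlacks : ∀ x l → yPart (withSlacks x) l ≡ ℤ.- (A ℤᴰ.*ᵥ x) l
  yPart-withSlacks x = lookup-++ʳ x _

  withSlacks-kernel : ∀ x → InKerℚ (appendId A) (toℚ ∘ withSlacks x)
  withSlacks-kernel x i = begin
    sumℚ (λ t → toℚ (appendId A i t) ℚ.* toℚ (withSlacks x t))
      ≡⟨ appendId-row (toℚ ∘ withSlacks x) i ⟩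
    (Aℚ ℚᴰ.*ᵥ toℚ ∘ xPart (withSlacks x)) i ℚ.+ toℚ (yPart (withSlacks x) i)
      ≡⟨ cong₂ ℚ._+_ (ℚᴰ.sum-cong-≗ (λ b → cong (λ e → Aℚ i b ℚ.* toℚ e) (xPart-withSlacks x b)))
                     (cong toℚ (yPart-withSlacks x i)) ⟩
    (Aℚ ℚᴰ.*ᵥ toℚ ∘ x) i ℚ.+ toℚ (ℤ.- (A ℤᴰ.*ᵥ x) i)
      ≡⟨ cong₂ ℚ._+_ (sym (toℚ-*ᵥ A x i)) (toℚ-neg ((A ℤᴰ.*ᵥ x) i)) ⟩
    toℚ ((A ℤᴰ.*ᵥ x) i) ℚ.+ ℚ.- toℚ ((A ℤᴰ.*ᵥ x) i)
      ≡⟨ ℚP.+-inverseʳ (toℚ ((A ℤᴰ.*ᵥ x) i)) ⟩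
    0ℚ ∎

  kernel-proportional : ∀ {p q} → InKerℚ (appendId A) p → InKerℚ (appendId A) q → ∀ a μ →
    (∀ b → xPart p b ℚ.* a ≡ μ ℚ.* xPart q b) → ∀ t → p t ℚ.* a ≡ μ ℚ.* q t
  kernel-proportional {p} {q} p-ker q-ker a μ x-prop = ↑ˡ-↑ʳ-elim x-prop y-prop
    where
    y-prop : ∀ l → yPart p l ℚ.* a ≡ μ ℚ.* yPart q l
    y-prop l = begin
      yPart p l ℚ.* a
        ≡⟨ cong (ℚ._* a) (kernel-yPart p-ker l) ⟩
      ℚ.- (Aℚ ℚᴰ.*ᵥ xPart p) l ℚ.* a
        ≡⟨ ℚᴰ.-‿distribˡ-* ((Aℚ ℚᴰ.*ᵥ xPart p) l) a ⟨
      ℚ.- ((Aℚ ℚᴰ.*ᵥ xPart p) l ℚ.* a)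
        ≡⟨ cong ℚ.-_ (ℚᴰ.*-distribʳ-sum a (λ b → Aℚ l b ℚ.* xPart p b)) ⟩
      ℚ.- ℚᴰ.sum (λ b → Aℚ l b ℚ.* xPart p b ℚ.* a)
        ≡⟨ cong ℚ.-_ (ℚᴰ.sum-cong-≗ (λ b → trans (ℚP.*-assoc (Aℚ l b) (xPart p b) a)
             (trans (cong (Aℚ l b ℚ.*_) (x-prop b)) (ℚᴰ.*-exchange (Aℚ l b) μ (xPart q b))))) ⟩
      ℚ.- ℚᴰ.sum (λ b → μ ℚ.* (Aℚ l b ℚ.* xPart q b))
        ≡⟨ cong ℚ.-_ (ℚᴰ.*-distribˡ-sum μ (λ b → Aℚ l b ℚ.* xPart q b)) ⟨
      ℚ.- (μ ℚ.* (Aℚ ℚᴰ.*ᵥ xPart q) l)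
        ≡⟨ ℚᴰ.-‿distribʳ-* μ _ ⟩
      μ ℚ.* ℚ.- (Aℚ ℚᴰ.*ᵥ xPart q) l
        ≡⟨ cong (μ ℚ.*_) (kernel-yPart q-ker l) ⟨
      μ ℚ.* yPart q l ∎

restrict : ∀ {A : Set} {m n k l} → Matrix A m n → (Fin k → Fin m) → (Fin l → Fin n) → Matrix A k l
restrict M ρ c i j = M (ρ i) (c j)

module UnimodularCircuits {m n} (A : Matrix ℤ m n) (TU : TotallyUnimodular A) where

  open SlackForm A
  open ≡-Reasoning

  ∣cofactor∣≤1 : ∀ {k} (ρ : Fin k → Fin m) (c : Fin (suc k) → Fin n) →
    Injective _≡_ _≡_ ρ → Injective _≡_ _≡_ c → ∀ j → ∣ ℤᴰ.cofactors (restrict A ρ c) j ∣ ℕ.≤ 1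
  ∣cofactor∣≤1 {k} ρ c ρ-inj c-inj j =
    subst (ℕ._≤ 1) ∣det∣≡∣cofactor∣ (TU k ρ (c ∘ punchIn j) ρ-inj (punchIn-injective j _ _ ∘ c-inj))
    where
    d = ℤᴰ.det k (submatrix A ρ (c ∘ punchIn j))
    ∣det∣≡∣cofactor∣ : ∣ det k (submatrix A ρ (c ∘ punchIn j)) ∣ ≡ ∣ ℤᴰ.sign j ℤ.* d ∣
    ∣det∣≡∣cofactor∣ =
      trans (cong ∣_∣ (det≡ℤdet k (submatrix A ρ (c ∘ punchIn j)))) (sym (∣unit*x∣≡∣x∣ (ℤᴰ.sign j) d (∣sign∣≡1 j)))

  module CofactorCircuit {k} (ρ : Fin k → Fin m) (c : Fin (suc k) → Fin n)
                         (ρ-inj : Injective _≡_ _≡_ ρ) (c-inj : Injective _≡_ _≡_ c) where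

    v : Vector ℤ (suc k)
    v = ℤᴰ.cofactors (restrict A ρ c)

    x : Vector ℤ n
    x = ℤᴰ.extend c v

    z : Vector ℤ (n ℕ.+ m)
    z = withSlacks x

    yPart-ρ≡0 : ∀ a → yPart z (ρ a) ≡ + 0
    yPart-ρ≡0 a = begin
      yPart z (ρ a)                       ≡⟨ yPart-withSlacks x (ρ a) ⟩
      ℤ.- (A ℤᴰ.*ᵥ x) (ρ a)              ≡⟨ cong ℤ.-_ (ℤᴰ.sum-extend c c-inj v (A (ρ a))) ⟩
      ℤ.- (restrict A ρ c ℤᴰ.*ᵥ v) a    ≡⟨ cong ℤ.-_ (ℤᴰ.cofactors-orthogonal (restrict A ρ c) a) ⟩
      + 0                                 ∎

    -- By Cramer's rule, q · V = Λ · z for V = v j₀ and Λ = q (c j₀), and Λ ≠ 0 since q ≠ 0.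
    support-minimal : ∀ j₀ → v j₀ ≢ + 0 → ∀ q → InKerℚ (appendId A) q → (∃ λ t → q t ≢ 0ℚ) →
      (∀ t → z t ≡ + 0 → q t ≡ 0ℚ) → ∀ t → z t ≢ + 0 → q t ≢ 0ℚ
    support-minimal j₀ vj₀≢0 q q-ker (t₀ , qt₀≢0) z≡0⇒q≡0 t zt≢0 qt≡0 =
      zt≢0 (toℚ-injective (ℚ-*-cancelˡ-≡0 Λ≢0
        (trans (sym (q*V≡Λ*z t)) (trans (cong (ℚ._* V) qt≡0) (ℚP.*-zeroˡ V)))))
      where
      V = toℚ (v j₀)
      Λ = xPart q (c j₀)
      q-outside : ∀ b → (∀ j → c j ≢ b) → xPart q b ≡ 0ℚ
      q-outside b b∉c = z≡0⇒q≡0 (b ↑ˡ m) (trans (xPart-withSlacks x b) (ℤᴰ.extend-outside c v b b∉c))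
      q∘c-kernel : ∀ a → ((λ r j → Aℚ (ρ r) (c j)) ℚᴰ.*ᵥ (xPart q ∘ c)) a ≡ 0ℚ
      q∘c-kernel a = begin
        ℚᴰ.sum (λ j → Aℚ (ρ a) (c j) ℚ.* xPart q (c j))
          ≡⟨ ℚᴰ.sum-image c c-inj (λ b → Aℚ (ρ a) b ℚ.* xPart q b)
               (λ b b∉c → trans (cong (Aℚ (ρ a) b ℚ.*_) (q-outside b b∉c)) (ℚP.*-zeroʳ (Aℚ (ρ a) b))) ⟨
        (Aℚ ℚᴰ.*ᵥ xPart q) (ρ a)
          ≡⟨ ℚP.+-identityʳ ((Aℚ ℚᴰ.*ᵥ xPart q) (ρ a)) ⟨
        (Aℚ ℚᴰ.*ᵥ xPart q) (ρ a) ℚ.+ 0ℚ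
          ≡⟨ cong ((Aℚ ℚᴰ.*ᵥ xPart q) (ρ a) ℚ.+_) (z≡0⇒q≡0 (n ↑ʳ ρ a) (yPart-ρ≡0 a)) ⟨
        (Aℚ ℚᴰ.*ᵥ xPart q) (ρ a) ℚ.+ yPart q (ρ a)
          ≡⟨ trans (sym (appendId-row q (ρ a))) (q-ker (ρ a)) ⟩
        0ℚ ∎
      cofactorsℚ≡ : ∀ j → ℚᴰ.cofactors (λ r j → Aℚ (ρ r) (c j)) j ≡ toℚ (v j)
      cofactorsℚ≡ j = sym (toℚ-cofactors (restrict A ρ c) j)
      xPart-proportional : ∀ b → xPart q b ℚ.* V ≡ Λ ℚ.* toℚ (xPart z b)
      xPart-proportional b with any? (λ j → c j ≟ b)
      ... | yes (j , refl) = begin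
        xPart q (c j) ℚ.* V
          ≡⟨ cong (xPart q (c j) ℚ.*_) (cofactorsℚ≡ j₀) ⟨
        xPart q (c j) ℚ.* ℚᴰ.cofactors (λ r j → Aℚ (ρ r) (c j)) j₀
          ≡⟨ ℚᴰ.kernel-∝-cofactors (λ r j → Aℚ (ρ r) (c j)) (xPart q ∘ c) q∘c-kernel j₀ j ⟩
        Λ ℚ.* ℚᴰ.cofactors (λ r j → Aℚ (ρ r) (c j)) j
          ≡⟨ cong (Λ ℚ.*_) (trans (cofactorsℚ≡ j) (cong toℚ (sym (ℤᴰ.extend-image c c-inj v j)))) ⟩
        Λ ℚ.* toℚ (x (c j))
          ≡⟨ cong (λ e → Λ ℚ.* toℚ e) (xPart-withSlacks x (c j)) ⟨
        Λ ℚ.* toℚ (xPart z (c j)) ∎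
      ... | no  b∉c = begin
        xPart q b ℚ.* V    ≡⟨ cong (ℚ._* V) (q-outside b (λ j cj≡b → b∉c (j , cj≡b))) ⟩
        0ℚ ℚ.* V           ≡⟨ ℚP.*-zeroˡ V ⟩
        0ℚ                 ≡⟨ ℚP.*-zeroʳ Λ ⟨
        Λ ℚ.* 0ℚ           ≡⟨ cong (λ e → Λ ℚ.* toℚ e) (trans (xPart-withSlacks x b)
                                (ℤᴰ.extend-outside c v b (λ j cj≡b → b∉c (j , cj≡b)))) ⟨
        Λ ℚ.* toℚ (xPart z b) ∎
      q*V≡Λ*z : ∀ t → q t ℚ.* V ≡ Λ ℚ.* toℚ (z t)
      q*V≡Λ*z = kernel-proportional q-ker (withSlacks-kernel x) V Λ xPart-proportional
      V≢0 : V ≢ 0ℚ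
      V≢0 V≡0 = vj₀≢0 (toℚ-injective V≡0)
      Λ≢0 : Λ ≢ 0ℚ
      Λ≢0 Λ≡0 = qt₀≢0 (ℚ-*-cancelˡ-≡0 V≢0 (begin
        V ℚ.* q t₀        ≡⟨ ℚP.*-comm V (q t₀) ⟩
        q t₀ ℚ.* V        ≡⟨ q*V≡Λ*z t₀ ⟩
        Λ ℚ.* toℚ (z t₀)  ≡⟨ cong (ℚ._* toℚ (z t₀)) Λ≡0 ⟩
        0ℚ ℚ.* toℚ (z t₀) ≡⟨ ℚP.*-zeroˡ (toℚ (z t₀)) ⟩
        0ℚ                ∎))

    isCircuit : ∀ j₀ → v j₀ ≢ + 0 → IsCircuit (appendId A) z
    isCircuit j₀ vj₀≢0 = withSlacks-kernel x , (c j₀ ↑ˡ m , vj₀≢0 ∘ trans (sym z₀≡v)) , gcd≡1 , minimal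
      where
      z₀≡v : z (c j₀ ↑ˡ m) ≡ v j₀
      z₀≡v = trans (xPart-withSlacks x (c j₀)) (ℤᴰ.extend-image c c-inj v j₀)
      gcd≡1 : gcdVec z ≡ 1
      gcd≡1 = ∣1⇒≡1 (subst (gcdVec z ∣_)
        (trans (cong ∣_∣ z₀≡v) (∣x∣≤1⇒∣x∣≡1 (v j₀) (∣cofactor∣≤1 ρ c ρ-inj c-inj j₀) vj₀≢0))
        (gcdVec-∣ z (c j₀ ↑ˡ m)))
      minimal : ∀ q → InKerℚ (appendId A) q → (∃ λ t → q t ≢ 0ℚ) →
        (∀ t → q t ≢ 0ℚ → z t ≢ + 0) → ∀ t → z t ≢ + 0 → q t ≢ 0ℚ
      minimal q q-ker q≢0 supp⊆ = support-minimal j₀ vj₀≢0 q q-ker q≢0 z≡0⇒q≡0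
        where
        z≡0⇒q≡0 : ∀ t → z t ≡ + 0 → q t ≡ 0ℚ
        z≡0⇒q≡0 t zt≡0 with q t ℚP.≟ 0ℚ
        ... | yes qt≡0 = qt≡0
        ... | no  qt≢0 = ⊥-elim (supp⊆ t qt≢0 zt≡0)

  record SignedCofactorVector (x : Vector ℤ n) : Set where
    field
      {k}            : ℕ
      rows           : Fin k → Fin m
      cols           : Fin (suc k) → Fin n
      rows-injective : Injective _≡_ _≡_ rows
      cols-injective : Injective _≡_ _≡_ cols
      scale          : ℤ
      ∣scale∣≡1      : ∣ scale ∣ ≡ 1
      x≡scale*cofactors : ∀ b → x b ≡ scale ℤ.* ℤᴰ.extend cols (ℤᴰ.cofactors (restrict A rows cols)) b

  module CircuitStructure {z : Vector ℤ (n ℕ.+ m)} (circuit : IsCircuit (appendId A) z) where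

    x : Vector ℤ n
    x = xPart z

    Ax≡0-at-zero-slack : ∀ i → yPart z i ≡ + 0 → (A ℤᴰ.*ᵥ x) i ≡ + 0
    Ax≡0-at-zero-slack i yi≡0 = begin
      (A ℤᴰ.*ᵥ x) i          ≡⟨ ℤP.neg-involutive ((A ℤᴰ.*ᵥ x) i) ⟨
      ℤ.- ℤ.- (A ℤᴰ.*ᵥ x) i  ≡⟨ cong ℤ.-_ (trans (sym (kernel-yPartℤ {z} (proj₁ circuit) i)) yi≡0) ⟩
      + 0                     ∎

    module ZeroSlacks = Enumeration (enumerate (λ i → yPart z i ℤP.≟ + 0))
    open ZeroSlacks using () renaming (size to r; elem to ρ₀)

    module Support {k} (c : Fin (suc k) → Fin n) (c-inj : Injective _≡_ _≡_ c)
                   (x∘c≢0 : ∀ j → x (c j) ≢ + 0) (x-outside : ∀ b → (∀ j → c j ≢ b) → x b ≡ + 0) where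

      -- u, extended by zero and completed by its slacks, is a kernel vector of [A I] supported
      -- in supp z and vanishing at c 0, so by minimality it is zero.
      tail-independent : ∀ u → (∀ a → (restrict A ρ₀ (c ∘ suc) ℤᴰ.*ᵥ u) a ≡ + 0) → ∀ j → u j ≡ + 0
      tail-independent u Bu≡0 j = toℚ-injective (begin
        toℚ (u j)                             ≡⟨ cong toℚ (ℤᴰ.extend-image (c ∘ suc) c∘suc-inj u j) ⟨
        toℚ (x′ (c (suc j)))                  ≡⟨ cong toℚ (xPart-withSlacks x′ (c (suc j))) ⟨
        toℚ (withSlacks x′ (c (suc j) ↑ˡ m))  ≡⟨ q≡0 (c (suc j) ↑ˡ m) ⟩
        0ℚ                                     ∎)
        where
        c∘suc-inj : Injective _≡_ _≡_ (c ∘ suc)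
        c∘suc-inj = suc-injective ∘ c-inj
        x′ : Vector ℤ n
        x′ = ℤᴰ.extend (c ∘ suc) u
        z≡0⇒q≡0 : ∀ t → z t ≡ + 0 → toℚ (withSlacks x′ t) ≡ 0ℚ
        z≡0⇒q≡0 = ↑ˡ-↑ʳ-elim
          (λ b xb≡0 → cong toℚ (trans (xPart-withSlacks x′ b)
            (ℤᴰ.extend-outside (c ∘ suc) u b (λ j cj≡b → x∘c≢0 (suc j) (trans (cong x cj≡b) xb≡0)))))
          (λ l yl≡0 → let a , ρ₀a≡l = ZeroSlacks.elem-complete l yl≡0 in cong toℚ (begin
            yPart (withSlacks x′) l                             ≡⟨ yPart-withSlacks x′ l ⟩
            ℤ.- (A ℤᴰ.*ᵥ x′) l                                  ≡⟨ cong (λ i → ℤ.- (A ℤᴰ.*ᵥ x′) i) ρ₀a≡l ⟨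
            ℤ.- (A ℤᴰ.*ᵥ x′) (ρ₀ a)                             ≡⟨ cong ℤ.-_ (ℤᴰ.sum-extend (c ∘ suc) c∘suc-inj u (A (ρ₀ a))) ⟩
            ℤ.- (restrict A ρ₀ (c ∘ suc) ℤᴰ.*ᵥ u) a             ≡⟨ cong ℤ.-_ (Bu≡0 a) ⟩
            + 0                                                  ∎))
        q≡0 : ∀ t → toℚ (withSlacks x′ t) ≡ 0ℚ
        q≡0 = circuit-minimal {M = appendId A} {z} circuit (toℚ ∘ withSlacks x′) (withSlacks-kernel x′) z≡0⇒q≡0
          (c zero ↑ˡ m) (x∘c≢0 zero)
          (cong toℚ (trans (xPart-withSlacks x′ (c zero))
            (ℤᴰ.extend-outside (c ∘ suc) u (c zero) (λ j csj≡c0 → 0≢1+n (c-inj (sym csj≡c0))))))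

      private
        nonsingular : Σ (Fin k → Fin r) λ σ → Injective _≡_ _≡_ σ × ℤᴰ.det k (restrict A ρ₀ (c ∘ suc) ∘ σ) ≢ + 0
        nonsingular = ℤᴰ.trivialKernel⇒nonsingularRows ℤP._≟_ (λ ()) k (restrict A ρ₀ (c ∘ suc)) tail-independent

      ρ : Fin k → Fin m
      ρ = ρ₀ ∘ proj₁ nonsingular

      ρ-inj : Injective _≡_ _≡_ ρ
      ρ-inj = proj₁ (proj₂ nonsingular) ∘ ZeroSlacks.elem-injective

      v : Vector ℤ (suc k)
      v = ℤᴰ.cofactors (restrict A ρ c)

      v₀*v₀≡1 : v zero ℤ.* v zero ≡ + 1
      v₀*v₀≡1 = ∣x∣≡1⇒x*x≡1 (v zero) (∣x∣≤1⇒∣x∣≡1 (v zero) (∣cofactor∣≤1 ρ c ρ-inj c-inj zero) v₀≢0)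
        where
        v₀≢0 : v zero ≢ + 0
        v₀≢0 v₀≡0 = proj₂ (proj₂ nonsingular) (trans (sym (ℤP.*-identityˡ (ℤᴰ.det k (restrict A ρ (c ∘ suc))))) v₀≡0)

      x∘c-kernel : ∀ a → (restrict A ρ c ℤᴰ.*ᵥ (x ∘ c)) a ≡ + 0
      x∘c-kernel a = begin
        ℤᴰ.sum (λ j → A (ρ a) (c j) ℤ.* x (c j))
          ≡⟨ ℤᴰ.sum-image c c-inj (λ b → A (ρ a) b ℤ.* x b)
               (λ b b∉c → trans (cong (A (ρ a) b ℤ.*_) (x-outside b b∉c)) (ℤP.*-zeroʳ (A (ρ a) b))) ⟨
        (A ℤᴰ.*ᵥ x) (ρ a)
          ≡⟨ Ax≡0-at-zero-slack (ρ a) (ZeroSlacks.elem-∈ (proj₁ nonsingular a)) ⟩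
        + 0 ∎

      scale : ℤ
      scale = x (c zero) ℤ.* v zero

      x∘c≡scale*v : ∀ j → x (c j) ≡ scale ℤ.* v j
      x∘c≡scale*v j = begin
        x (c j)                               ≡⟨ ℤP.*-identityʳ (x (c j)) ⟨
        x (c j) ℤ.* + 1                       ≡⟨ cong (x (c j) ℤ.*_) v₀*v₀≡1 ⟨
        x (c j) ℤ.* (v zero ℤ.* v zero)       ≡⟨ ℤP.*-assoc (x (c j)) (v zero) (v zero) ⟨
        x (c j) ℤ.* v zero ℤ.* v zero         ≡⟨ cong (ℤ._* v zero) (ℤᴰ.kernel-∝-cofactors (restrict A ρ c) (x ∘ c) x∘c-kernel zero j) ⟩
        x (c zero) ℤ.* v j ℤ.* v zero         ≡⟨ ℤP.*-assoc (x (c zero)) (v j) (v zero) ⟩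
        x (c zero) ℤ.* (v j ℤ.* v zero)       ≡⟨ cong (x (c zero) ℤ.*_) (ℤP.*-comm (v j) (v zero)) ⟩
        x (c zero) ℤ.* (v zero ℤ.* v j)       ≡⟨ ℤP.*-assoc (x (c zero)) (v zero) (v j) ⟨
        scale ℤ.* v j                         ∎

      x≡scale*cofactors : ∀ b → x b ≡ scale ℤ.* ℤᴰ.extend c v b
      x≡scale*cofactors = ℤᴰ.as-scaled-extend c c-inj x scale v x∘c≡scale*v x-outside

      z≡scale*withSlacks : ∀ t → z t ≡ scale ℤ.* withSlacks (ℤᴰ.extend c v) t
      z≡scale*withSlacks t = toℚ-injective (begin
        toℚ (z t)                     ≡⟨ ℚP.*-identityʳ (toℚ (z t)) ⟨
        toℚ (z t) ℚ.* 1ℚ              ≡⟨ kernel-proportional {toℚ ∘ z} (proj₁ circuit) (withSlacks-kernel e) 1ℚ (toℚ scale) x-prop t ⟩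
        toℚ scale ℚ.* toℚ (withSlacks e t) ≡⟨ toℚ-* scale (withSlacks e t) ⟨
        toℚ (scale ℤ.* withSlacks e t)     ∎)
        where
        e = ℤᴰ.extend c v
        x-prop : ∀ b → toℚ (x b) ℚ.* 1ℚ ≡ toℚ scale ℚ.* toℚ (xPart (withSlacks e) b)
        x-prop b = begin
          toℚ (x b) ℚ.* 1ℚ              ≡⟨ ℚP.*-identityʳ (toℚ (x b)) ⟩
          toℚ (x b)                     ≡⟨ cong toℚ (x≡scale*cofactors b) ⟩
          toℚ (scale ℤ.* e b)           ≡⟨ toℚ-* scale (e b) ⟩
          toℚ scale ℚ.* toℚ (e b)       ≡⟨ cong (λ e′ → toℚ scale ℚ.* toℚ e′) (xPart-withSlacks e b) ⟨
          toℚ scale ℚ.* toℚ (xPart (withSlacks e) b) ∎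

      signedCofactorVector : SignedCofactorVector x
      signedCofactorVector = record
        { rows = ρ ; cols = c ; rows-injective = ρ-inj ; cols-injective = c-inj ; scale = scale
        ; ∣scale∣≡1 = gcdVec≡1⇒∣factor∣≡1 scale z≡scale*withSlacks (proj₁ (proj₂ (proj₂ circuit)))
        ; x≡scale*cofactors = x≡scale*cofactors }

    x≢0 : ∃ λ b → x b ≢ + 0
    x≢0 with any? (λ b → ¬? (x b ℤP.≟ + 0))
    ... | yes found = found
    ... | no  none  = ⊥-elim (zt≢0 (z≡0 t))
      where
      t = proj₁ (proj₁ (proj₂ circuit))
      zt≢0 = proj₂ (proj₁ (proj₂ circuit))
      x≡0 : ∀ b → x b ≡ + 0
      x≡0 b with x b ℤP.≟ + 0
      ... | yes xb≡0 = xb≡0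
      ... | no  xb≢0 = ⊥-elim (none (b , xb≢0))
      z≡0 : ∀ t → z t ≡ + 0
      z≡0 = ↑ˡ-↑ʳ-elim x≡0 (λ l → trans (kernel-yPartℤ {z} (proj₁ circuit) l) (cong ℤ.-_ (Ax≡0 l)))
        where
        Ax≡0 : ∀ l → (A ℤᴰ.*ᵥ x) l ≡ + 0
        Ax≡0 l = ℤᴰ.sum-zero (λ b → A l b ℤ.* x b) (λ b → trans (cong (A l b ℤ.*_) (x≡0 b)) (ℤP.*-zeroʳ (A l b)))

    module SuppX = Enumeration (enumerate (λ b → ¬? (x b ℤP.≟ + 0)))

    signedCofactorVector : SignedCofactorVector x
    signedCofactorVector = fromSupport SuppX.elem SuppX.elem-injective SuppX.elem-∈ outside
      (proj₁ (SuppX.elem-complete (proj₁ x≢0) (proj₂ x≢0)))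
      where
      outside : ∀ b → (∀ j → SuppX.elem j ≢ b) → x b ≡ + 0
      outside b b∉ with x b ℤP.≟ + 0
      ... | yes xb≡0 = xb≡0
      ... | no  xb≢0 = ⊥-elim (let j , eq = SuppX.elem-complete b xb≢0 in b∉ j eq)
      fromSupport : ∀ {s} (c : Fin s → Fin n) → Injective _≡_ _≡_ c → (∀ j → x (c j) ≢ + 0) →
        (∀ b → (∀ j → c j ≢ b) → x b ≡ + 0) → Fin s → SignedCofactorVector x
      fromSupport {suc k} c c-inj x∘c≢0 x-outside _ = Support.signedCofactorVector c c-inj x∘c≢0 x-outside

  circuit⇒signedCofactorVector : ∀ {z} → IsCircuit (appendId A) z → SignedCofactorVector (xPart z)
  circuit⇒signedCofactorVector circuit = CircuitStructure.signedCofactorVector circuit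

module AppendedRow {m n} (A : Matrix ℤ m n) (w : Vector ℤ n) where

  open SlackForm A

  lastRow : Fin (m ℕ.+ 1)
  lastRow = m ↑ʳ zero

  appendRow-↑ˡ : ∀ i j → appendRow A w (i ↑ˡ 1) j ≡ A i j
  appendRow-↑ˡ i j rewrite splitAt-↑ˡ m i 1 = refl

  appendRow-lastRow : ∀ j → appendRow A w lastRow j ≡ w j
  appendRow-lastRow j rewrite splitAt-↑ʳ m 1 zero = refl

  ↑ˡ≢lastRow : ∀ i → i ↑ˡ 1 ≢ lastRow
  ↑ˡ≢lastRow i eq with trans (sym (splitAt-↑ˡ m i 1)) (trans (cong (splitAt m) eq) (splitAt-↑ʳ m 1 zero))
  ... | ()

  below-lastRow : ∀ i → i ≢ lastRow → ∃ λ a → a ↑ˡ 1 ≡ i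
  below-lastRow = ↑ˡ-↑ʳ-elim (λ a _ → a , refl) (λ { zero i≢lastRow → ⊥-elim (i≢lastRow refl) })

  rows-below-lastRow : ∀ {k} (r : Fin k → Fin (m ℕ.+ 1)) → Injective _≡_ _≡_ r → (∀ p → r p ≢ lastRow) →
    Σ (Fin k → Fin m) λ rA → Injective _≡_ _≡_ rA × (∀ p → rA p ↑ˡ 1 ≡ r p)
  rows-below-lastRow r r-inj r≢lastRow = proj₁ ∘ below , rA-inj , proj₂ ∘ below
    where
    below : ∀ p → ∃ λ a → a ↑ˡ 1 ≡ r p
    below p = below-lastRow (r p) (r≢lastRow p)
    rA-inj : Injective _≡_ _≡_ (proj₁ ∘ below)
    rA-inj {p} {q} eq = r-inj (trans (sym (proj₂ (below p))) (trans (cong (_↑ˡ 1) eq) (proj₂ (below q))))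

  lastRow∷ : ∀ {k} → (Fin k → Fin m) → Fin (suc k) → Fin (m ℕ.+ 1)
  lastRow∷ ρ = lastRow ∷ (_↑ˡ 1) ∘ ρ

  lastRow∷-injective : ∀ {k} {ρ : Fin k → Fin m} → Injective _≡_ _≡_ ρ → Injective _≡_ _≡_ (lastRow∷ ρ)
  lastRow∷-injective ρ-inj {zero}  {zero}  _  = refl
  lastRow∷-injective ρ-inj {zero}  {suc b} eq = ⊥-elim (↑ˡ≢lastRow _ (sym eq))
  lastRow∷-injective ρ-inj {suc a} {zero}  eq = ⊥-elim (↑ˡ≢lastRow _ eq)
  lastRow∷-injective ρ-inj {suc a} {suc b} eq = cong suc (ρ-inj (↑ˡ-injective 1 _ _ eq))

  det-lastRow∷ : ∀ {k} (ρ : Fin k → Fin m) (c : Fin (suc k) → Fin n) →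
    ℤᴰ.det (suc k) (submatrix (appendRow A w) (lastRow∷ ρ) c)
      ≡ ℤᴰ.sum (λ j → w (c j) ℤ.* ℤᴰ.cofactors (restrict A ρ c) j)
  det-lastRow∷ {k} ρ c = trans (ℤᴰ.det-cong (suc k) rows) (ℤᴰ.det-∷ (w ∘ c) (restrict A ρ c))
    where
    rows : ∀ r j → submatrix (appendRow A w) (lastRow∷ ρ) c r j ≡ (w ∘ c ∷ restrict A ρ c) r j
    rows zero    j = appendRow-lastRow (c j)
    rows (suc a) j = appendRow-↑ˡ (ρ a) (c j)

  dot-scaled-extend : ∀ {k} (c : Fin k → Fin n) → Injective _≡_ _≡_ c → ∀ v s x →
    (∀ b → x b ≡ s ℤ.* ℤᴰ.extend c v b) → dot w x ≡ s ℤ.* ℤᴰ.sum (λ j → w (c j) ℤ.* v j)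
  dot-scaled-extend c c-inj v s x x≡s*e = begin
    dot w x                                         ≡⟨ sumℤ≡ℤsum (λ b → w b ℤ.* x b) ⟩
    ℤᴰ.sum (λ b → w b ℤ.* x b)                      ≡⟨ ℤᴰ.sum-cong-≗ (λ b → trans (cong (w b ℤ.*_) (x≡s*e b))
                                                                                (ℤᴰ.*-exchange (w b) s _)) ⟩
    ℤᴰ.sum (λ b → s ℤ.* (w b ℤ.* ℤᴰ.extend c v b))  ≡⟨ ℤᴰ.*-distribˡ-sum s (λ b → w b ℤ.* ℤᴰ.extend c v b) ⟨
    s ℤ.* ℤᴰ.sum (λ b → w b ℤ.* ℤᴰ.extend c v b)    ≡⟨ cong (s ℤ.*_) (ℤᴰ.sum-extend c c-inj v w) ⟩
    s ℤ.* ℤᴰ.sum (λ j → w (c j) ℤ.* v j)            ∎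
    where open ≡-Reasoning

  module _ (TU : TotallyUnimodular A) (Δ : ℕ) where

    open UnimodularCircuits A TU
    open ℕP.≤-Reasoning

    circuits-bounded : TotallyΔModular Δ (appendRow A w) →
      ∀ z → IsCircuit (appendId A) z → ∣ dot w (xPart z) ∣ ℕ.≤ Δ
    circuits-bounded tΔm z circuit = begin
      ∣ dot w (xPart z) ∣
        ≡⟨ cong ∣_∣ (dot-scaled-extend cols cols-injective v scale (xPart z) x≡scale*cofactors) ⟩
      ∣ scale ℤ.* ℤᴰ.sum (λ j → w (cols j) ℤ.* v j) ∣
        ≡⟨ ∣unit*x∣≡∣x∣ scale (ℤᴰ.sum (λ j → w (cols j) ℤ.* v j)) ∣scale∣≡1 ⟩
      ∣ ℤᴰ.sum (λ j → w (cols j) ℤ.* v j) ∣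
        ≡⟨ cong ∣_∣ (trans (det≡ℤdet (suc k) M) (det-lastRow∷ rows cols)) ⟨
      ∣ det (suc k) M ∣
        ≤⟨ tΔm (suc k) (lastRow∷ rows) cols (lastRow∷-injective rows-injective) cols-injective ⟩
      Δ ∎
      where
      open SignedCofactorVector (circuit⇒signedCofactorVector circuit)
      v = ℤᴰ.cofactors (restrict A rows cols)
      M = submatrix (appendRow A w) (lastRow∷ rows) cols

    module _ (circuits-bounded : ∀ z → IsCircuit (appendId A) z → ∣ dot w (xPart z) ∣ ℕ.≤ Δ) where

      cofactor-dot-bounded : ∀ {k} (ρ : Fin k → Fin m) (c : Fin (suc k) → Fin n) →
        Injective _≡_ _≡_ ρ → Injective _≡_ _≡_ c →
        ∣ ℤᴰ.sum (λ j → w (c j) ℤ.* ℤᴰ.cofactors (restrict A ρ c) j) ∣ ℕ.≤ Δ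
      cofactor-dot-bounded ρ c ρ-inj c-inj with any? (λ j → ¬? (ℤᴰ.cofactors (restrict A ρ c) j ℤP.≟ + 0))
      ... | yes (j₀ , vj₀≢0) = begin
        ∣ ℤᴰ.sum (λ j → w (c j) ℤ.* v j) ∣
          ≡⟨ cong ∣_∣ (ℤP.*-identityˡ (ℤᴰ.sum (λ j → w (c j) ℤ.* v j))) ⟨
        ∣ + 1 ℤ.* ℤᴰ.sum (λ j → w (c j) ℤ.* v j) ∣
          ≡⟨ cong ∣_∣ (dot-scaled-extend c c-inj v (+ 1) (xPart z) (λ b → trans (xPart-withSlacks x b) (sym (ℤP.*-identityˡ _)))) ⟨
        ∣ dot w (xPart z) ∣
          ≤⟨ circuits-bounded z (isCircuit j₀ vj₀≢0) ⟩
        Δ ∎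
        where open CofactorCircuit ρ c ρ-inj c-inj
      ... | no  v≢0 = begin
        ∣ ℤᴰ.sum (λ j → w (c j) ℤ.* v j) ∣
          ≡⟨ cong ∣_∣ (ℤᴰ.sum-zero _ (λ j → trans (cong (w (c j) ℤ.*_) (vj≡0 j)) (ℤP.*-zeroʳ (w (c j))))) ⟩
        0
          ≤⟨ ℕ.z≤n ⟩
        Δ ∎
        where
        open CofactorCircuit ρ c ρ-inj c-inj
        vj≡0 : ∀ j → v j ≡ + 0
        vj≡0 j with v j ℤP.≟ + 0
        ... | yes vj≡0 = vj≡0
        ... | no  vj≢0 = ⊥-elim (v≢0 (j , vj≢0))

      det-bounded-through-lastRow : ∀ {k} (r : Fin k → Fin (m ℕ.+ 1)) (c : Fin k → Fin n) →
        Injective _≡_ _≡_ r → Injective _≡_ _≡_ c → ∀ p → r p ≡ lastRow →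
        ∣ det k (submatrix (appendRow A w) r c) ∣ ℕ.≤ Δ
      det-bounded-through-lastRow {suc k} r c r-inj c-inj p rp≡lastRow = begin
        ∣ det (suc k) M ∣
          ≡⟨ cong ∣_∣ (trans (det≡ℤdet (suc k) M) (ℤᴰ.sign-cancel p (ℤᴰ.det-bringToTop k p M))) ⟩
        ∣ ℤᴰ.sign p ℤ.* ℤᴰ.det (suc k) (M ∘ ℤᴰ.bringToTop p) ∣
          ≡⟨ ∣unit*x∣≡∣x∣ (ℤᴰ.sign p) (ℤᴰ.det (suc k) (M ∘ ℤᴰ.bringToTop p)) (∣sign∣≡1 p) ⟩
        ∣ ℤᴰ.det (suc k) (M ∘ ℤᴰ.bringToTop p) ∣
          ≡⟨ cong ∣_∣ (trans (ℤᴰ.det-cong (suc k) rows-moved) (det-lastRow∷ rA c)) ⟩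
        ∣ ℤᴰ.sum (λ j → w (c j) ℤ.* ℤᴰ.cofactors (restrict A rA c) j) ∣
          ≤⟨ cofactor-dot-bounded rA c rA-inj c-inj ⟩
        Δ ∎
        where
        M = submatrix (appendRow A w) r c
        others : Σ (Fin k → Fin m) λ rA → Injective _≡_ _≡_ rA × (∀ a → rA a ↑ˡ 1 ≡ r (punchIn p a))
        others = rows-below-lastRow (r ∘ punchIn p) (punchIn-injective p _ _ ∘ r-inj)
          (λ a eq → punchInᵢ≢i p a (r-inj (trans eq (sym rp≡lastRow))))
        rA = proj₁ others
        rA-inj = proj₁ (proj₂ others)
        rows-moved : ∀ i j → (M ∘ ℤᴰ.bringToTop p) i j ≡ submatrix (appendRow A w) (lastRow∷ rA) c i j
        rows-moved zero    j = cong (λ i → appendRow A w i (c j)) rp≡lastRow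
        rows-moved (suc a) j = cong (λ i → appendRow A w i (c j)) (sym (proj₂ (proj₂ others) a))

      totallyΔModular : 1 ℕ.≤ Δ → TotallyΔModular Δ (appendRow A w)
      totallyΔModular 1≤Δ k r c r-inj c-inj with any? (λ p → r p ≟ lastRow)
      ... | yes (p , rp≡lastRow) = det-bounded-through-lastRow r c r-inj c-inj p rp≡lastRow
      ... | no  lastRow∉r = begin
        ∣ det k (submatrix (appendRow A w) r c) ∣
          ≡⟨ cong ∣_∣ (trans (det≡ℤdet k _) (trans (ℤᴰ.det-cong k rows-of-A) (sym (det≡ℤdet k _)))) ⟩
        ∣ det k (submatrix A rA c) ∣
          ≤⟨ TU k rA c rA-inj c-inj ⟩
        1
          ≤⟨ 1≤Δ ⟩
        Δ ∎
        where
        below : Σ (Fin k → Fin m) λ rA → Injective _≡_ _≡_ rA × (∀ p → rA p ↑ˡ 1 ≡ r p)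
        below = rows-below-lastRow r r-inj (λ p eq → lastRow∉r (p , eq))
        rA = proj₁ below
        rA-inj = proj₁ (proj₂ below)
        rows-of-A : ∀ p j → submatrix (appendRow A w) r c p j ≡ submatrix A rA c p j
        rows-of-A p j = trans (cong (λ i → appendRow A w i (c j)) (sym (proj₂ (proj₂ below) p))) (appendRow-↑ˡ (rA p) (c j))

lemma2p1 : ∀ {m n} (A : Matrix ℤ m n) (w : Fin n → ℤ) (Δ : ℕ) →
    ZeroPmOne A → TotallyUnimodular A → 1 ℕ.≤ Δ →
    (TotallyΔModular Δ (appendRow A w)
    ⇔ (∀ (z : Fin (n ℕ.+ m) → ℤ) → IsCircuit (appendId A) z →
    ∣ dot w (λ j → z (j ↑ˡ m)) ∣ ℕ.≤ Δ))
lemma2p1 A w Δ _ TU 1≤Δ = mk⇔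
  (AppendedRow.circuits-bounded A w TU Δ)
  (λ bounded → AppendedRow.totallyΔModular A w TU Δ bounded 1≤Δ)
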